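{- For any countably infinite field $k$, the countable rational Urysohn ultrametric space $\mathbb{U}$ is isometric to the ultrametric reduct of the valued field $k(t^{\mathbb{Q}})$.
   Context: The Hahn field $k[[t^{\mathbb{Q}}]]$ consists of formal series $a=\sum_{q\in\mathbb{Q}}a_qt^q$ with $a_q\in k$ and well-ordered support $\mathrm{supp}(a)=\{q:a_q\ne0\}$, with the usual addition and multiplication, and valuation $v(a)=\min(\mathrm{supp}(a))\in\mathbb{Q}\cup\{\infty\}$. $k[t^{\mathbb{Q}}]$ is the subring of series with finite support and $k(t^{\mathbb{Q}})$ its field of fractions inside $k[[t^{\mathbb{Q}}]]$. Its ultrametric reduct is the two-sorted ultrametric space with points $k(t^{\mathbb{Q}})$, distance set $\{e^{ -q}:q\in\mathbb{Q}\cup\{\infty\}\}$ (with $e^{ -\infty}=0$, ordered as reals, hence order-isomorphic to $\mathbb{Q}^{\ge0}$ via an isomorphism preserving $0$) and distance $d(a,b)=e^{ -v(a-b)}$. $\mathbb{U}$ is the countable rational Urysohn ultrametric space (the Fraïssé limit of finite ultrametric spaces with rational distances and isometric embeddings) with distance set $\mathbb{Q}^{\ge0}$; "isometric" means after identifying the two distance sets by the order isomorphism. -}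

module Defs where

open import Level using (0ℓ)
open import Algebra.Bundles using (CommutativeRing)
open import Data.Nat using (ℕ)
open import Data.Fin using (Fin)
open import Data.Rational using (ℚ; 0ℚ; _<_; _≤_; _⊔_; _≟_)
import Data.Rational as ℚ
open import Data.Maybe using (Maybe; just; nothing)
import Data.Maybe as Maybe
open import Data.List using (List; []; _∷_; _++_; map; concatMap; foldr)
open import Data.Product using (Σ; ∃; _×_; _,_)
open import Data.Bool using (if_then_else_)
open import Relation.Nullary using (¬_; does)
open import Relation.Binary.PropositionalEquality using (_≡_)
import Relation.Binary.PropositionalEquality as ≡
open import Function.Bundles using (Bijection; _⤖_; Func)
open import Data.Empty using (⊥)
open import Data.Unit using (⊤)

module _ (R : CommutativeRing 0ℓ 0ℓ) where
  open CommutativeRing R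

  IsField : Set
  IsField = (¬ (1# ≈ 0#)) × (∀ x → ¬ (x ≈ 0#) → ∃ λ y → x * y ≈ 1#)

  CountablyInfinite : Set
  CountablyInfinite = Bijection (CommutativeRing.setoid R) (≡.setoid ℕ)

module Series (R : CommutativeRing 0ℓ 0ℓ) where
  open CommutativeRing R renaming (Carrier to K)

  -- an element of k[t^ℚ] is a finite formal sum  Σ c t^e , given as a
  -- list of terms (e , c)
  Poly : Set
  Poly = List (ℚ × K)

  coeff : Poly → ℚ → K
  coeff p q = foldr (λ { (e , c) acc → if does (e ≟ q) then c + acc else acc }) 0# p

  _·_ : Poly → Poly → Poly
  p · p' = concatMap (λ { (e , c) → map (λ { (e' , c') → (e ℚ.+ e' , c * c') }) p' }) p

  _⊖_ : Poly → Poly → Poly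
  p ⊖ p' = p ++ map (λ { (e , c) → (e , - c) }) p'

  -- valuation: `IsVal p w` says v(p) = w, where w ∈ ℚ ∪ {∞}
  -- (nothing = ∞), v(p) = min supp(p)
  IsVal : Poly → Maybe ℚ → Set
  IsVal p nothing  = ∀ q → coeff p q ≈ 0#
  IsVal p (just q) = (¬ (coeff p q ≈ 0#)) × (∀ r → r < q → coeff p r ≈ 0#)

  -- elements of k(t^ℚ): fractions num/den with den ≠ 0
  record Frac : Set where
    constructor _/_[_]
    field
      num : Poly
      den : Poly
      den≢0 : ¬ (∀ q → coeff den q ≈ 0#)

  -- valuation of a/b - c/d = (ad - cb)/(bd) : v = v(ad - cb) - v(bd)
  IsValDiff : Frac → Frac → Maybe ℚ → Set
  IsValDiff x y w =
    Σ (Maybe ℚ) λ wn → Σ ℚ λ wd →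
      IsVal ((num x · den y) ⊖ (num y · den x)) wn ×
      IsVal (den x · den y) (just wd) ×
      (w ≡ Maybe.map (λ a → a ℚ.- wd) wn)
    where open Frac

record IsUltrametric {X : Set} (d : X → X → ℚ) : Set where
  field
    nonneg : ∀ x y → 0ℚ ≤ d x y
    zero⇒eq : ∀ x y → d x y ≡ 0ℚ → x ≡ y
    eq⇒zero : ∀ x → d x x ≡ 0ℚ
    sym : ∀ x y → d x y ≡ d y x
    ultra : ∀ x y z → d x z ≤ (d x y ⊔ d y z)

-- the countable rational Urysohn ultrametric space, as the Fraïssé limit
-- of the class of finite ultrametric spaces with rational distances:
-- a countable (infinite) ultrametric space whose age is that class and
-- which is ultrahomogeneous.
record RationalUrysohn : Set₁ where
  field
    Carrier : Set
    d : Carrier → Carrier → ℚ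
    isUltrametric : IsUltrametric d
    countable : Carrier ⤖ ℕ
    -- age ⊇ finite rational ultrametric spaces (⊆ is automatic)
    universal : ∀ n (δ : Fin n → Fin n → ℚ) → IsUltrametric δ →
                ∃ λ (e : Fin n → Carrier) → ∀ i j → d (e i) (e j) ≡ δ i j
    ultrahomogeneous : ∀ n (f g : Fin n → Carrier) →
                (∀ i j → d (f i) (f j) ≡ d (g i) (g j)) →
                ∃ λ (σ : Carrier ⤖ Carrier) →
                  (∀ x y → d (Bijection.to σ x) (Bijection.to σ y) ≡ d x y) ×
                  (∀ i → Bijection.to σ (f i) ≡ g i)

-- Identification of distance sets: {e^{-q} : q ∈ ℚ ∪ {∞}} (encoded by the
-- exponent q ∈ Maybe ℚ, nothing = ∞) with ℚ^{≥0} by an order isomorphism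
-- preserving 0.  e^{-q} < e^{-q'} iff q' < q (with q < ∞ for finite q).

_<∞_ : Maybe ℚ → Maybe ℚ → Set
just a  <∞ just b  = a < b
just a  <∞ nothing = ⊤
nothing <∞ _       = ⊥

record DistIso : Set where
  field
    φ : Maybe ℚ → ℚ
    φ-∞ : φ nothing ≡ 0ℚ
    φ-nonneg : ∀ w → 0ℚ ≤ φ w
    φ-onto : ∀ r → 0ℚ ≤ r → ∃ λ w → φ w ≡ r
    φ-order : ∀ w w' → w <∞ w' → φ w' < φ w

{-# OPTIONS --safe #-}
-- Write v(x − y) for the valuation of a difference in k(t^ℚ) and δ x y = φ (v(x − y)) for the
-- corresponding distance.  This countable ultrametric space has the one-point extension property
-- characterising the Urysohn space: to realise admissible distances ρᵢ to finitely many yᵢ, take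
-- a yᵢ with ρᵢ least, the q with φ q = ρᵢ, and x = yᵢ + c t^q.  Then v(x − yⱼ) = min (q, v(yᵢ − yⱼ))
-- unless the lowest terms of x − yⱼ cancel, which happens for at most one c per j; as k is
-- infinite, some c ≠ 0 avoids all of them.  The extension property on both sides drives a
-- back-and-forth construction of a surjective isometry onto U along enumerations of both spaces.
module Submission where

open import Defs
open import Level using (0ℓ)
open import Algebra.Bundles using (CommutativeRing)
open import Data.Bool using (if_then_else_)
open import Data.Empty using (⊥; ⊥-elim)
open import Data.Fin as Fin using (Fin; zero; suc)
open import Data.Fin.Properties using (any?)
open import Data.Integer as ℤ using (ℤ)
open import Data.List using (List; []; _∷_; _++_; map; concatMap; filter; length; lookup; allFin)
import Data.List.Extrema
open import Data.List.Membership.Propositional using (_∈_)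
open import Data.List.Membership.Propositional.Properties using (∈-lookup; ∈-allFin; ∈-filter⁺; ∈-filter⁻)
open import Data.List.Properties using (concatMap-++; filter-accept; filter-reject; map-∘)
open import Data.List.Relation.Binary.Subset.Propositional using (_⊆_)
open import Data.List.Relation.Binary.Subset.Propositional.Properties using (⊆-refl; ⊆-trans)
import Data.List.Relation.Unary.All as All
open import Data.List.Relation.Unary.Any using (here; there; index)
open import Data.List.Relation.Unary.Any.Properties using (lookup-index)
open import Data.Maybe using (Maybe; just; nothing)
import Data.Maybe
open import Data.Maybe.Properties using (just-injective)
open import Data.Nat as ℕ using (ℕ; zero; suc)
import Data.Nat.Properties as ℕ
open import Data.Product using (Σ; ∃; ∃₂; _×_; _,_; proj₁; proj₂)
open import Data.Rational as ℚ using (ℚ; 0ℚ; mkℚ; _<_; _≤_; _⊔_; _⊓_; _≟_; _≤?_)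
import Data.Rational.Properties as ℚ
open import Data.Rational.Properties
  using (≤-refl; ≤-reflexive; ≤-trans; ≤-antisym; ≤-total; <-cmp; <-irrefl; <⇒≤; <⇒≢;
         ≤-<-trans; <-≤-trans; ⊔-comm; ⊔-idem; ⊔-lub; p≤p⊔q; p≤q⊔p; p≤q⇒p⊔q≡q; p≥q⇒p⊔q≡p;
         p⊓q≤p; p⊓q≤q; p≤q⇒p⊓q≡p; p≥q⇒p⊓q≡q; mono-≤-distrib-⊓; +-monoˡ-≤; ≤-decTotalOrder)
open import Data.Rational.Solver using (module +-*-Solver)
open import Data.Sum using (_⊎_; inj₁; inj₂; [_,_]′)
open import Data.Unit using (⊤; tt)
import Data.Vec.Functional as Vector
open import Function using (id; _∘_)
open import Function.Bundles using (Bijection)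
open import Relation.Binary.Bundles using (Setoid; DecTotalOrder)
open import Relation.Binary.Definitions using (Decidable; tri<; tri≈; tri>)
open import Relation.Binary.PropositionalEquality using (_≡_; _≢_; module ≡-Reasoning)
import Relation.Binary.PropositionalEquality as ≡
open import Relation.Nullary using (¬_; does; yes; no)
open import Relation.Nullary.Decidable using (¬?; decidable-stable)
import Relation.Nullary.Decidable as Dec

≤∧≢⇒< : ∀ {p q} → p ≤ q → p ≢ q → p < q
≤∧≢⇒< {p} {q} p≤q p≢q with <-cmp p q
... | tri< p<q _ _ = p<q
... | tri≈ _ p≡q _ = ⊥-elim (p≢q p≡q)
... | tri> _ _ p>q = ⊥-elim (<-irrefl ≡.refl (≤-<-trans p≤q p>q))

p+[q-p]≡q : ∀ p q → p ℚ.+ (q ℚ.- p) ≡ q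
p+[q-p]≡q = solve 2 (λ p q → p :+ (q :- p) := q) ≡.refl
  where open +-*-Solver

[p+q]-p≡q : ∀ p q → (p ℚ.+ q) ℚ.- p ≡ q
[p+q]-p≡q = solve 2 (λ p q → (p :+ q) :- p := q) ≡.refl
  where open +-*-Solver

[r-p]-q≡[r-q]-p : ∀ r p q → (r ℚ.- p) ℚ.- q ≡ (r ℚ.- q) ℚ.- p
[r-p]-q≡[r-q]-p = solve 3 (λ r p q → (r :- p) :- q := (r :- q) :- p) ≡.refl
  where open +-*-Solver

r<a+b⇒r-e<b : ∀ {r a b e} → r < a ℚ.+ b → a ≤ e → r ℚ.- e < b
r<a+b⇒r-e<b {r} {a} {b} {e} r<a+b a≤e = ℚ.≤-<-trans (ℚ.+-monoʳ-≤ r (ℚ.neg-antimono-≤ a≤e))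
  (≡.subst (r ℚ.- a <_) ([p+q]-p≡q a b) (ℚ.+-monoˡ-< (ℚ.- a) r<a+b))

record IsPseudoUltrametric {X : Set} (δ : X → X → ℚ) : Set where
  field
    nonneg : ∀ x y → 0ℚ ≤ δ x y
    eq⇒zero : ∀ x → δ x x ≡ 0ℚ
    sym : ∀ x y → δ x y ≡ δ y x
    ultra : ∀ x y z → δ x z ≤ δ x y ⊔ δ y z

isUltrametric⇒isPseudoUltrametric : ∀ {X} {δ : X → X → ℚ} → IsUltrametric δ → IsPseudoUltrametric δ
isUltrametric⇒isPseudoUltrametric u = record { IsUltrametric u }

-- An ultrametric Katětov function on the points xs: the distances from a
-- new point to them.  Positivity makes the new point distinct from all xs.
record IsKatetov {X : Set} (δ : X → X → ℚ) {n} (xs : Fin n → X) (ρ : Fin n → ℚ) : Set where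
  field
    positive : ∀ i → 0ℚ < ρ i
    ρ-ultra : ∀ i j → ρ j ≤ ρ i ⊔ δ (xs i) (xs j)
    δ-ultra : ∀ i j → δ (xs i) (xs j) ≤ ρ i ⊔ ρ j

IsKatetov-transport : ∀ {X Y} {δ : X → X → ℚ} {δ' : Y → Y → ℚ} {n}
  {xs : Fin n → X} {ys : Fin n → Y} {ρ} →
  (∀ i j → δ (xs i) (xs j) ≡ δ' (ys i) (ys j)) → IsKatetov δ xs ρ → IsKatetov δ' ys ρ
IsKatetov-transport {ρ = ρ} xs≅ys κ = record
  { positive = positive
  ; ρ-ultra = λ i j → ≡.subst (λ t → ρ j ≤ ρ i ⊔ t) (xs≅ys i j) (ρ-ultra i j)
  ; δ-ultra = λ i j → ≡.subst (_≤ ρ i ⊔ ρ j) (xs≅ys i j) (δ-ultra i j)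
  }
  where open IsKatetov κ

ExtensionProperty : {X : Set} → (X → X → ℚ) → Set
ExtensionProperty {X} δ = ∀ n (xs : Fin n → X) (ρ : Fin n → ℚ) → IsKatetov δ xs ρ →
  ∃ λ x → ∀ i → δ x (xs i) ≡ ρ i

module PseudoUltrametricProperties {X : Set} {δ : X → X → ℚ} (δ-pu : IsPseudoUltrametric δ) where
  open IsPseudoUltrametric δ-pu renaming (sym to δ-sym)

  zero-≤ʳ : ∀ x {y y'} → δ y' y ≡ 0ℚ → δ x y ≤ δ x y'
  zero-≤ʳ x {y} {y'} δy'y≡0 = begin
    δ x y            ≤⟨ ultra x y' y ⟩
    δ x y' ⊔ δ y' y  ≡⟨ ≡.cong (δ x y' ⊔_) δy'y≡0 ⟩
    δ x y' ⊔ 0ℚ      ≡⟨ p≥q⇒p⊔q≡p (nonneg x y') ⟩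
    δ x y'           ∎
    where open ℚ.≤-Reasoning

  zero-congʳ : ∀ x {y y'} → δ y y' ≡ 0ℚ → δ x y ≡ δ x y'
  zero-congʳ x {y} {y'} δyy'≡0 =
    ≤-antisym (zero-≤ʳ x (≡.trans (δ-sym y' y) δyy'≡0)) (zero-≤ʳ x δyy'≡0)

  zero-cong : ∀ {x x' y y'} → δ x x' ≡ 0ℚ → δ y y' ≡ 0ℚ → δ x y ≡ δ x' y'
  zero-cong {x} {x'} {y} {y'} δxx'≡0 δyy'≡0 = begin
    δ x y    ≡⟨ zero-congʳ x δyy'≡0 ⟩
    δ x y'   ≡⟨ δ-sym x y' ⟩
    δ y' x   ≡⟨ zero-congʳ y' δxx'≡0 ⟩
    δ y' x'  ≡⟨ δ-sym y' x' ⟩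
    δ x' y'  ∎
    where open ≡-Reasoning

  distances-isKatetov : ∀ x {n} (ys : Fin n → X) → (∀ i → δ x (ys i) ≢ 0ℚ) →
    IsKatetov δ ys (λ i → δ x (ys i))
  distances-isKatetov x ys apart = record
    { positive = λ i → ≤∧≢⇒< (nonneg x (ys i)) (apart i ∘ ≡.sym)
    ; ρ-ultra = λ i j → ultra x (ys i) (ys j)
    ; δ-ultra = λ i j →
        ≡.subst (λ t → δ (ys i) (ys j) ≤ t ⊔ δ x (ys j)) (δ-sym (ys i) x) (ultra (ys i) x (ys j))
    }

adjoinPoint : ∀ {n} → (Fin n → Fin n → ℚ) → (Fin n → ℚ) → Fin (suc n) → Fin (suc n) → ℚ
adjoinPoint δ ρ zero    zero    = 0ℚ
adjoinPoint δ ρ zero    (suc j) = ρ j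
adjoinPoint δ ρ (suc i) zero    = ρ i
adjoinPoint δ ρ (suc i) (suc j) = δ i j

adjoinPoint-isUltrametric : ∀ {n} {δ : Fin n → Fin n → ℚ} {ρ} → IsUltrametric δ → IsKatetov δ id ρ →
  IsUltrametric (adjoinPoint δ ρ)
adjoinPoint-isUltrametric {δ = δ} {ρ} δ-u κ = record
  { nonneg = nonneg′ ; zero⇒eq = zero⇒eq′ ; eq⇒zero = eq⇒zero′ ; sym = sym′ ; ultra = ultra′ }
  where
  open IsUltrametric δ-u
  open IsKatetov κ
  δ′ = adjoinPoint δ ρ

  ρ≥0 : ∀ i → 0ℚ ≤ ρ i
  ρ≥0 i = <⇒≤ (positive i)

  nonneg′ : ∀ x y → 0ℚ ≤ δ′ x y
  nonneg′ zero    zero    = ≤-refl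
  nonneg′ zero    (suc j) = ρ≥0 j
  nonneg′ (suc i) zero    = ρ≥0 i
  nonneg′ (suc i) (suc j) = nonneg i j

  zero⇒eq′ : ∀ x y → δ′ x y ≡ 0ℚ → x ≡ y
  zero⇒eq′ zero    zero    _ = ≡.refl
  zero⇒eq′ zero    (suc j) e = ⊥-elim (<⇒≢ (positive j) (≡.sym e))
  zero⇒eq′ (suc i) zero    e = ⊥-elim (<⇒≢ (positive i) (≡.sym e))
  zero⇒eq′ (suc i) (suc j) e = ≡.cong suc (zero⇒eq i j e)

  eq⇒zero′ : ∀ x → δ′ x x ≡ 0ℚ
  eq⇒zero′ zero    = ≡.refl
  eq⇒zero′ (suc i) = eq⇒zero i

  sym′ : ∀ x y → δ′ x y ≡ δ′ y x
  sym′ zero    zero    = ≡.refl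
  sym′ zero    (suc j) = ≡.refl
  sym′ (suc i) zero    = ≡.refl
  sym′ (suc i) (suc j) = sym i j

  ultra′ : ∀ x y z → δ′ x z ≤ δ′ x y ⊔ δ′ y z
  ultra′ zero    zero    zero    = ≤-reflexive (≡.sym (⊔-idem 0ℚ))
  ultra′ zero    zero    (suc k) = p≤q⊔p 0ℚ (ρ k)
  ultra′ zero    (suc j) zero    = ≤-trans (ρ≥0 j) (p≤p⊔q (ρ j) (ρ j))
  ultra′ zero    (suc j) (suc k) = ρ-ultra j k
  ultra′ (suc i) zero    zero    = p≤p⊔q (ρ i) 0ℚ
  ultra′ (suc i) zero    (suc k) = δ-ultra i k
  ultra′ (suc i) (suc j) zero    =
    ≡.subst (ρ i ≤_) (≡.trans (⊔-comm (ρ j) (δ j i)) (≡.cong (_⊔ ρ j) (sym j i))) (ρ-ultra j i)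
  ultra′ (suc i) (suc j) (suc k) = ultra i j k

-- Back and forth against the Urysohn space

module _ (U : RationalUrysohn) where
  open RationalUrysohn U renaming (Carrier to C)

  d-isPseudoUltrametric : IsPseudoUltrametric d
  d-isPseudoUltrametric = isUltrametric⇒isPseudoUltrametric isUltrametric

  restrict-isUltrametric : ∀ {n} (us : Fin n → C) → (∀ i j → d (us i) (us j) ≡ 0ℚ → i ≡ j) →
    IsUltrametric (λ i j → d (us i) (us j))
  restrict-isUltrametric us separated = record
    { nonneg = λ i j → nonneg (us i) (us j)
    ; zero⇒eq = separated
    ; eq⇒zero = λ i → eq⇒zero (us i)
    ; sym = λ i j → sym (us i) (us j)
    ; ultra = λ i j k → ultra (us i) (us j) (us k)
    }
    where open IsUltrametric isUltrametric

  -- Universality realises the one-point extension somewhere in U, and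
  -- ultrahomogeneity moves it over us.
  urysohn-extension : ∀ {n} (us : Fin n → C) → (∀ i j → d (us i) (us j) ≡ 0ℚ → i ≡ j) →
    ∀ {ρ} → IsKatetov d us ρ → ∃ λ u → ∀ i → d u (us i) ≡ ρ i
  urysohn-extension {n} us separated {ρ} κ = Bijection.to σ (e zero) , e₀-distances
    where
    δ = λ i j → d (us i) (us j)
    realised = universal (suc n) (adjoinPoint δ ρ)
      (adjoinPoint-isUltrametric (restrict-isUltrametric us separated) (IsKatetov-transport (λ _ _ → ≡.refl) κ))
    e = proj₁ realised
    moved = ultrahomogeneous n (e ∘ suc) us (λ i j → proj₂ realised (suc i) (suc j))
    σ = proj₁ moved

    e₀-distances : ∀ i → d (Bijection.to σ (e zero)) (us i) ≡ ρ i
    e₀-distances i = begin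
      d (Bijection.to σ (e zero)) (us i)                      ≡⟨ ≡.cong (d _) (≡.sym (proj₂ (proj₂ moved) i)) ⟩
      d (Bijection.to σ (e zero)) (Bijection.to σ (e (suc i))) ≡⟨ proj₁ (proj₂ moved) (e zero) (e (suc i)) ⟩
      d (e zero) (e (suc i))                                  ≡⟨ proj₂ realised zero (suc i) ⟩
      ρ i                                                     ∎
      where open ≡-Reasoning

module BackAndForth (U : RationalUrysohn) {X : Set} {δ : X → X → ℚ}
  (δ-pu : IsPseudoUltrametric δ) (δ-ext : ExtensionProperty δ)
  (enum : ℕ → X) (enum-onto : ∀ x → ∃ λ k → δ (enum k) x ≡ 0ℚ) where

  open RationalUrysohn U renaming (Carrier to C)
  open IsUltrametric isUltrametric using (zero⇒eq)
  open IsPseudoUltrametric (d-isPseudoUltrametric U)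
  open IsPseudoUltrametric δ-pu using () renaming (eq⇒zero to δ-eq⇒zero; sym to δ-sym)
  open PseudoUltrametricProperties δ-pu using (zero-cong; distances-isKatetov)
  open PseudoUltrametricProperties (d-isPseudoUltrametric U) using ()
    renaming (distances-isKatetov to d-distances-isKatetov)

  record PartialIsometry : Set where
    field
      graph : List (X × C)

    dom : Fin (length graph) → X
    dom i = proj₁ (lookup graph i)

    img : Fin (length graph) → C
    img i = proj₂ (lookup graph i)

    field
      isometric : ∀ {p q} → p ∈ graph → q ∈ graph → d (proj₂ p) (proj₂ q) ≡ δ (proj₁ p) (proj₁ q)
      -- needed to present the images as a finite ultrametric space to universality
      separated : ∀ i j → d (img i) (img j) ≡ 0ℚ → i ≡ j

    at-index : {P : X × C → Set} → (∀ i → P (lookup graph i)) → ∀ {p} → p ∈ graph → P p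
    at-index {P} P-lookup p∈ = ≡.subst P (≡.sym (lookup-index p∈)) (P-lookup (index p∈))

    isometric-at : ∀ i j → d (img i) (img j) ≡ δ (dom i) (dom j)
    isometric-at i j = isometric (∈-lookup i) (∈-lookup j)

  open PartialIsometry

  _≼_ : PartialIsometry → PartialIsometry → Set
  S ≼ S' = graph S ⊆ graph S'

  empty : PartialIsometry
  empty = record { graph = [] ; isometric = λ () ; separated = λ () }

  adjoin : (S : PartialIsometry) (x : X) (u : C) →
    (∀ i → d u (img S i) ≡ δ x (dom S i)) → (∀ i → d u (img S i) ≢ 0ℚ) → PartialIsometry
  adjoin S x u u-iso u-apart = record
    { graph = (x , u) ∷ graph S ; isometric = isometric′ ; separated = separated′ }
    where
    u-iso∈ : ∀ {q} → q ∈ graph S → d u (proj₂ q) ≡ δ x (proj₁ q)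
    u-iso∈ = at-index S u-iso

    isometric′ : ∀ {p q} → p ∈ (x , u) ∷ graph S → q ∈ (x , u) ∷ graph S →
      d (proj₂ p) (proj₂ q) ≡ δ (proj₁ p) (proj₁ q)
    isometric′ (here ≡.refl) (here ≡.refl) = ≡.trans (eq⇒zero u) (≡.sym (δ-eq⇒zero x))
    isometric′ (here ≡.refl) (there q∈) = u-iso∈ q∈
    isometric′ {p} (there p∈) (here ≡.refl) =
      ≡.trans (sym (proj₂ p) u) (≡.trans (u-iso∈ p∈) (δ-sym x (proj₁ p)))
    isometric′ (there p∈) (there q∈) = isometric S p∈ q∈

    separated′ : ∀ i j → _
    separated′ zero    zero    _ = ≡.refl
    separated′ zero    (suc j) z = ⊥-elim (u-apart j z)
    separated′ (suc i) zero    z = ⊥-elim (u-apart i (≡.trans (sym u (img S i)) z))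
    separated′ (suc i) (suc j) z = ≡.cong suc (separated S i j z)

  forth : (x : X) (S : PartialIsometry) →
    Σ PartialIsometry λ S' → S ≼ S' × ∃₂ λ x' u → (x' , u) ∈ graph S' × δ x x' ≡ 0ℚ
  forth x S with any? (λ i → δ x (dom S i) ≟ 0ℚ)
  ... | yes (i , x≈dom) = S , id , dom S i , img S i , ∈-lookup i , x≈dom
  ... | no x-new = adjoin S x u u-iso u-apart , there , x , u , here ≡.refl , δ-eq⇒zero x
    where
    x-apart : ∀ i → δ x (dom S i) ≢ 0ℚ
    x-apart i z = x-new (i , z)

    realised = urysohn-extension U (img S) (separated S)
      (IsKatetov-transport (λ i j → ≡.sym (isometric-at S i j)) (distances-isKatetov x (dom S) x-apart))
    u = proj₁ realised
    u-iso = proj₂ realised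

    u-apart : ∀ i → d u (img S i) ≢ 0ℚ
    u-apart i z = x-apart i (≡.trans (≡.sym (u-iso i)) z)

  back : (u : C) (S : PartialIsometry) → Σ PartialIsometry λ S' → S ≼ S' × ∃ λ x → (x , u) ∈ graph S'
  back u S with any? (λ i → d u (img S i) ≟ 0ℚ)
  ... | yes (i , u≈img) = S , id , dom S i , ≡.subst (λ v → (dom S i , v) ∈ graph S) img≡u (∈-lookup i)
    where img≡u = zero⇒eq (img S i) u (≡.trans (sym (img S i) u) u≈img)
  ... | no u-new = adjoin S x u (λ i → ≡.sym (x-iso i)) u-apart , there , x , here ≡.refl
    where
    u-apart : ∀ i → d u (img S i) ≢ 0ℚ
    u-apart i z = u-new (i , z)

    realised = δ-ext _ (dom S) _
      (IsKatetov-transport (isometric-at S) (d-distances-isKatetov u (img S) u-apart))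
    x = proj₁ realised
    x-iso = proj₂ realised

  point : ℕ → C
  point k = proj₁ (Bijection.surjective countable k)

  point-onto : ∀ u → point (Bijection.to countable u) ≡ u
  point-onto u = Bijection.injective countable (proj₂ (Bijection.surjective countable _) ≡.refl)

  record Recorded (S : PartialIsometry) (x : X) : Set where
    field
      partner : X
      image : C
      ∈graph : (partner , image) ∈ graph S
      ≈partner : δ x partner ≡ 0ℚ

  record Extension (k : ℕ) (S : PartialIsometry) : Set where
    field
      next : PartialIsometry
      extends : S ≼ next
      records-enum : Recorded next (enum k)
      records-point : ∃ λ x → (x , point k) ∈ graph next

  forth-back : ∀ k S → Extension k S
  forth-back k S
    with S′ , S≼S′ , x , u , xu∈ , enum≈x ← forth (enum k) S
    with S″ , S′≼S″ , point-recorded ← back (point k) S′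
    = record
      { next = S″
      ; extends = ⊆-trans S≼S′ S′≼S″
      ; records-enum = record { partner = x ; image = u ; ∈graph = S′≼S″ xu∈ ; ≈partner = enum≈x }
      ; records-point = point-recorded
      }

  stage : ℕ → PartialIsometry
  stage zero    = empty
  stage (suc k) = Extension.next (forth-back k (stage k))

  stage-suc : ∀ k → stage k ≼ stage (suc k)
  stage-suc k = Extension.extends (forth-back k (stage k))

  stage-+ : ∀ m k → stage m ≼ stage (k ℕ.+ m)
  stage-+ m zero    = ⊆-refl
  stage-+ m (suc k) = ⊆-trans (stage-+ m k) (stage-suc (k ℕ.+ m))

  stage-mono : ∀ {m n} → m ℕ.≤ n → stage m ≼ stage n
  stage-mono {m} {n} m≤n = ≡.subst (λ t → stage m ≼ stage t) (ℕ.m∸n+n≡m m≤n) (stage-+ m (n ℕ.∸ m))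

  isometric-across : ∀ m n {x y u v} → (x , u) ∈ graph (stage m) → (y , v) ∈ graph (stage n) →
    d u v ≡ δ x y
  isometric-across m n xu∈ yv∈ =
    isometric (stage (m ℕ.⊔ n)) (stage-mono (ℕ.m≤m⊔n m n) xu∈) (stage-mono (ℕ.m≤n⊔m m n) yv∈)

  recorded : ∀ x → Σ ℕ λ N → Recorded (stage N) x
  recorded x = suc k , record
    { partner = partner ; image = image ; ∈graph = ∈graph
    ; ≈partner = begin
      δ x partner         ≡⟨ zero-cong (≡.trans (δ-sym x (enum k)) enum≈x)
                                       (≡.trans (δ-sym partner (enum k)) ≈partner) ⟩
      δ (enum k) (enum k) ≡⟨ δ-eq⇒zero (enum k) ⟩
      0ℚ                  ∎
    }
    where
    open ≡-Reasoning
    k = proj₁ (enum-onto x)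
    enum≈x = proj₂ (enum-onto x)
    open Recorded (Extension.records-enum (forth-back k (stage k)))

  F : X → C
  F x = Recorded.image (proj₂ (recorded x))

  F-isometric : ∀ x y → d (F x) (F y) ≡ δ x y
  F-isometric x y = ≡.trans (isometric-across M N (∈graph rx) (∈graph ry))
                            (≡.sym (zero-cong (≈partner rx) (≈partner ry)))
    where
    open Recorded
    M = proj₁ (recorded x)
    N = proj₁ (recorded y)
    rx = proj₂ (recorded x)
    ry = proj₂ (recorded y)

  F-onto : ∀ u → ∃ λ x → F x ≡ u
  F-onto u = x , ≡.trans (zero⇒eq (F x) (point k) F-x≈point) (point-onto u)
    where
    k = Bijection.to countable u
    x = proj₁ (Extension.records-point (forth-back k (stage k)))
    x-point∈ = proj₂ (Extension.records-point (forth-back k (stage k)))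
    open Recorded (proj₂ (recorded x))
    F-x≈point = ≡.trans (isometric-across (proj₁ (recorded x)) (suc k) ∈graph x-point∈)
                        (≡.trans (δ-sym partner x) ≈partner)

isometry-onto-urysohn : (U : RationalUrysohn) {X : Set} {δ : X → X → ℚ} →
  IsPseudoUltrametric δ → ExtensionProperty δ →
  (enum : ℕ → X) → (∀ x → ∃ λ k → δ (enum k) x ≡ 0ℚ) →
  Σ (X → RationalUrysohn.Carrier U) λ F →
    (∀ u → ∃ λ x → F x ≡ u) × (∀ x y → RationalUrysohn.d U (F x) (F y) ≡ δ x y)
isometry-onto-urysohn U δ-pu δ-ext enum enum-onto = F , F-onto , F-isometric
  where open BackAndForth U δ-pu δ-ext enum enum-onto

-- Distances measured by valuations in ℚ ∪ {∞}

infix 4 _≤∞_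
infixl 7 _⊓∞_

_≤∞_ : Maybe ℚ → Maybe ℚ → Set
_       ≤∞ nothing = ⊤
nothing ≤∞ just _  = ⊥
just a  ≤∞ just b  = a ≤ b

_⊓∞_ : Maybe ℚ → Maybe ℚ → Maybe ℚ
nothing ⊓∞ w       = w
just a  ⊓∞ nothing = just a
just a  ⊓∞ just b  = just (a ⊓ b)

≤∞-refl : ∀ w → w ≤∞ w
≤∞-refl nothing  = tt
≤∞-refl (just a) = ≤-refl

≤∞-total : ∀ w w' → w ≤∞ w' ⊎ w' ≤∞ w
≤∞-total w        nothing  = inj₁ tt
≤∞-total nothing  (just b) = inj₂ tt
≤∞-total (just a) (just b) = ≤-total a b

≤∞⇒<∞⊎≡ : ∀ {w w'} → w ≤∞ w' → w <∞ w' ⊎ w ≡ w'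
≤∞⇒<∞⊎≡ {nothing} {nothing} _ = inj₂ ≡.refl
≤∞⇒<∞⊎≡ {just a}  {nothing} _ = inj₁ tt
≤∞⇒<∞⊎≡ {just a}  {just b}  a≤b with <-cmp a b
... | tri< a<b _ _ = inj₁ a<b
... | tri≈ _ a≡b _ = inj₂ (≡.cong just a≡b)
... | tri> _ _ a>b = ⊥-elim (<-irrefl ≡.refl (≤-<-trans a≤b a>b))

⊓∞-≤ˡ : ∀ w w' → w ⊓∞ w' ≤∞ w
⊓∞-≤ˡ nothing  w'       = tt
⊓∞-≤ˡ (just a) nothing  = ≤-refl
⊓∞-≤ˡ (just a) (just b) = p⊓q≤p a b

⊓∞-≤ʳ : ∀ w w' → w ⊓∞ w' ≤∞ w'
⊓∞-≤ʳ nothing  w'       = ≤∞-refl w'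
⊓∞-≤ʳ (just a) nothing  = tt
⊓∞-≤ʳ (just a) (just b) = p⊓q≤q a b

w≤∞w'⇒w⊓∞w'≡w : ∀ {w w'} → w ≤∞ w' → w ⊓∞ w' ≡ w
w≤∞w'⇒w⊓∞w'≡w {nothing} {nothing} _   = ≡.refl
w≤∞w'⇒w⊓∞w'≡w {just a}  {nothing} _   = ≡.refl
w≤∞w'⇒w⊓∞w'≡w {just a}  {just b}  a≤b = ≡.cong just (p≤q⇒p⊓q≡p a≤b)

w'≤∞w⇒w⊓∞w'≡w' : ∀ {w w'} → w' ≤∞ w → w ⊓∞ w' ≡ w'
w'≤∞w⇒w⊓∞w'≡w' {nothing} {w'}      _   = ≡.refl
w'≤∞w⇒w⊓∞w'≡w' {just a}  {just b}  b≤a = ≡.cong just (p≥q⇒p⊓q≡q b≤a)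

<∞-≤∞-trans : ∀ {w w' w''} → w <∞ w' → w' ≤∞ w'' → w <∞ w''
<∞-≤∞-trans {just a} {just b}  {just c}  a<b b≤c = <-≤-trans a<b b≤c
<∞-≤∞-trans {just a} {just b}  {nothing} _   _   = tt
<∞-≤∞-trans {just a} {nothing} {nothing} _   _   = tt

infixl 6 _+∞_

_+∞_ : Maybe ℚ → ℚ → Maybe ℚ
w +∞ c = Data.Maybe.map (ℚ._+ c) w

+∞-+∞ : ∀ w a b → (w +∞ a) +∞ b ≡ w +∞ (a ℚ.+ b)
+∞-+∞ nothing  a b = ≡.refl
+∞-+∞ (just e) a b = ≡.cong just (ℚ.+-assoc e a b)

⊓∞-+∞ : ∀ w w' c → (w ⊓∞ w') +∞ c ≡ (w +∞ c) ⊓∞ (w' +∞ c)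
⊓∞-+∞ nothing  w'       c = ≡.refl
⊓∞-+∞ (just a) nothing  c = ≡.refl
⊓∞-+∞ (just a) (just b) c = ≡.cong just (mono-≤-distrib-⊓ (+-monoˡ-≤ c) a b)

+∞-monoˡ-≤∞ : ∀ {w w'} c → w ≤∞ w' → w +∞ c ≤∞ w' +∞ c
+∞-monoˡ-≤∞ {w}      {nothing} c _   = tt
+∞-monoˡ-≤∞ {just a} {just b}  c a≤b = +-monoˡ-≤ c a≤b

record IsValuationDistance {X : Set} (v : X → X → Maybe ℚ) : Set where
  field
    self : ∀ x → v x x ≡ nothing
    sym : ∀ x y → v x y ≡ v y x
    ultra : ∀ x y z → v x y ⊓∞ v y z ≤∞ v x z

BranchingProperty : {X : Set} → (X → X → Maybe ℚ) → Set
BranchingProperty {X} v =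
  ∀ x q n (ys : Fin n → X) → ∃ λ x' → ∀ j → v x' (ys j) ≡ v x (ys j) ⊓∞ just q

module _ (ι : DistIso) where
  open DistIso ι

  φ-antitone : ∀ {w w'} → w ≤∞ w' → φ w' ≤ φ w
  φ-antitone = [ <⇒≤ ∘ φ-order _ _ , ≤-reflexive ∘ ≡.cong φ ∘ ≡.sym ]′ ∘ ≤∞⇒<∞⊎≡

  φ-⊓∞ : ∀ w w' → φ (w ⊓∞ w') ≡ φ w ⊔ φ w'
  φ-⊓∞ w w' with ≤∞-total w w'
  ... | inj₁ w≤w' = ≡.trans (≡.cong φ (w≤∞w'⇒w⊓∞w'≡w w≤w')) (≡.sym (p≥q⇒p⊔q≡p (φ-antitone w≤w')))
  ... | inj₂ w'≤w = ≡.trans (≡.cong φ (w'≤∞w⇒w⊓∞w'≡w' w'≤w)) (≡.sym (p≤q⇒p⊔q≡q (φ-antitone w'≤w)))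

  φ-positive : ∀ {r} → 0ℚ < r → ∃ λ q → φ (just q) ≡ r
  φ-positive {r} r>0 with φ-onto r (<⇒≤ r>0)
  ... | nothing , φ∞≡r = ⊥-elim (<⇒≢ r>0 (≡.trans (≡.sym φ-∞) φ∞≡r))
  ... | just q  , φq≡r = q , φq≡r

  module _ {X : Set} {v : X → X → Maybe ℚ} where

    φ-isPseudoUltrametric : IsValuationDistance v → IsPseudoUltrametric (λ x y → φ (v x y))
    φ-isPseudoUltrametric v-dist = record
      { nonneg = λ x y → φ-nonneg (v x y)
      ; eq⇒zero = λ x → ≡.trans (≡.cong φ (self x)) φ-∞
      ; sym = λ x y → ≡.cong φ (sym x y)
      ; ultra = λ x y z → ≡.subst (φ (v x z) ≤_) (φ-⊓∞ (v x y) (v y z)) (φ-antitone (ultra x y z))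
      }
      where open IsValuationDistance v-dist

    -- Branch off from a yᵢ nearest to the new point, at the height q with φ q = ρᵢ.
    φ-extensionProperty : X → BranchingProperty v → ExtensionProperty (λ x y → φ (v x y))
    φ-extensionProperty x₀ branch zero    ys ρ κ = x₀ , λ ()
    φ-extensionProperty x₀ branch (suc n) ys ρ κ = x' , x'-distances
      where
      open IsKatetov κ
      open Data.List.Extrema (DecTotalOrder.totalOrder ≤-decTotalOrder) using (argmin; f[argmin]≤f[xs])
      i₀ = argmin ρ zero (allFin (suc n))
      ρ-minimal : ∀ j → ρ i₀ ≤ ρ j
      ρ-minimal j = All.lookup (f[argmin]≤f[xs] {f = ρ} zero (allFin (suc n))) (∈-allFin j)
      q = proj₁ (φ-positive (positive i₀))
      x' = proj₁ (branch (ys i₀) q (suc n) ys)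

      x'-distances : ∀ j → φ (v x' (ys j)) ≡ ρ j
      x'-distances j = begin
        φ (v x' (ys j))                   ≡⟨ ≡.cong φ (proj₂ (branch (ys i₀) q (suc n) ys) j) ⟩
        φ (v (ys i₀) (ys j) ⊓∞ just q)    ≡⟨ φ-⊓∞ _ (just q) ⟩
        φ (v (ys i₀) (ys j)) ⊔ φ (just q) ≡⟨ ≡.cong (φ (v (ys i₀) (ys j)) ⊔_) φq≡ρi₀ ⟩
        φ (v (ys i₀) (ys j)) ⊔ ρ i₀       ≡⟨ ⊔-comm _ (ρ i₀) ⟩
        ρ i₀ ⊔ φ (v (ys i₀) (ys j))       ≡⟨ ≤-antisym (⊔-lub (ρ-minimal j) δ≤ρj) (ρ-ultra i₀ j) ⟩
        ρ j                               ∎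
        where
        open ≡-Reasoning
        φq≡ρi₀ = proj₂ (φ-positive (positive i₀))
        δ≤ρj = ≤-trans (δ-ultra i₀ j) (≤-reflexive (p≤q⇒p⊔q≡q (ρ-minimal j)))

-- Coefficient arithmetic of finite Hahn series

module ListSum (R : CommutativeRing 0ℓ 0ℓ) where
  open CommutativeRing R renaming (Carrier to K)
  open import Algebra.Properties.Ring ring using (-0#≈0#; -‿+-comm; -‿distribˡ-*)
  open import Relation.Binary.Reasoning.Setoid setoid

  ∑ : {A : Set} → List A → (A → K) → K
  ∑ []       f = 0#
  ∑ (x ∷ xs) f = f x + ∑ xs f

  syntax ∑ xs (λ x → e) = ∑[ x ∈ xs ] e

  private variable A B : Set

  ∑-cong : ∀ (xs : List A) {f g : A → K} → (∀ x → f x ≈ g x) → ∑ xs f ≈ ∑ xs g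
  ∑-cong []       f≈g = refl
  ∑-cong (x ∷ xs) f≈g = +-cong (f≈g x) (∑-cong xs f≈g)

  ∑-cong-∈ : ∀ (xs : List A) {f g : A → K} → (∀ {x} → x ∈ xs → f x ≈ g x) → ∑ xs f ≈ ∑ xs g
  ∑-cong-∈ []       f≈g = refl
  ∑-cong-∈ (x ∷ xs) f≈g = +-cong (f≈g (here ≡.refl)) (∑-cong-∈ xs (f≈g ∘ there))

  ∑-zero : ∀ (xs : List A) → ∑[ x ∈ xs ] 0# ≈ 0#
  ∑-zero []       = refl
  ∑-zero (x ∷ xs) = trans (+-identityˡ _) (∑-zero xs)

  ∑-++ : ∀ (xs ys : List A) (f : A → K) → ∑ (xs ++ ys) f ≈ ∑ xs f + ∑ ys f
  ∑-++ []       ys f = sym (+-identityˡ _)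
  ∑-++ (x ∷ xs) ys f = trans (+-congˡ (∑-++ xs ys f)) (sym (+-assoc _ _ _))

  ∑-+ : ∀ (xs : List A) (f g : A → K) → ∑[ x ∈ xs ] (f x + g x) ≈ ∑ xs f + ∑ xs g
  ∑-+ []       f g = sym (+-identityˡ _)
  ∑-+ (x ∷ xs) f g = trans (+-congˡ (∑-+ xs f g)) (interchange (f x) (g x) _ _)
    where open import Algebra.Properties.CommutativeSemigroup +-commutativeSemigroup using (interchange)

  ∑-*ˡ : ∀ (xs : List A) c (f : A → K) → ∑[ x ∈ xs ] (c * f x) ≈ c * ∑ xs f
  ∑-*ˡ []       c f = sym (zeroʳ c)
  ∑-*ˡ (x ∷ xs) c f = trans (+-congˡ (∑-*ˡ xs c f)) (sym (distribˡ c _ _))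

  ∑-*ʳ : ∀ (xs : List A) c (f : A → K) → ∑[ x ∈ xs ] (f x * c) ≈ ∑ xs f * c
  ∑-*ʳ xs c f = trans (∑-cong xs (λ x → *-comm (f x) c)) (trans (∑-*ˡ xs c f) (*-comm c _))

  ∑-neg : ∀ (xs : List A) (f : A → K) → ∑[ x ∈ xs ] (- f x) ≈ - ∑ xs f
  ∑-neg []       f = sym -0#≈0#
  ∑-neg (x ∷ xs) f = trans (+-congˡ (∑-neg xs f)) (-‿+-comm (f x) _)

  ∑-swap : (xs : List A) (ys : List B) (f : A → B → K) →
    ∑[ x ∈ xs ] ∑[ y ∈ ys ] f x y ≈ ∑[ y ∈ ys ] ∑[ x ∈ xs ] f x y
  ∑-swap []       ys f = sym (∑-zero ys)
  ∑-swap (x ∷ xs) ys f = trans (+-congˡ (∑-swap xs ys f)) (sym (∑-+ ys (f x) _))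

  ∑-map : (g : A → B) (xs : List A) (f : B → K) → ∑ (map g xs) f ≡ ∑[ x ∈ xs ] f (g x)
  ∑-map g []       f = ≡.refl
  ∑-map g (x ∷ xs) f = ≡.cong (f (g x) +_) (∑-map g xs f)

  ∑-concatMap : (g : A → List B) (xs : List A) (f : B → K) →
    ∑ (concatMap g xs) f ≈ ∑[ x ∈ xs ] ∑ (g x) f
  ∑-concatMap g []       f = refl
  ∑-concatMap g (x ∷ xs) f = trans (∑-++ (g x) (concatMap g xs) f) (+-congˡ (∑-concatMap g xs f))

module SeriesArithmetic (R : CommutativeRing 0ℓ 0ℓ) where
  open CommutativeRing R renaming (Carrier to K)
  open Series R
  open ListSum R
  open import Algebra.Properties.Ring ring using (-0#≈0#; -‿+-comm; -‿distribˡ-*; -‿involutive)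
  open import Relation.Binary.Reasoning.Setoid setoid

  monomialCoeff : ℚ × K → ℚ → K
  monomialCoeff (e , c) r = if does (e ≟ r) then c else 0#

  monomialCoeff-≡ : ∀ r c → monomialCoeff (r , c) r ≈ c
  monomialCoeff-≡ r c with r ≟ r
  ... | yes _   = refl
  ... | no  r≢r = ⊥-elim (r≢r ≡.refl)

  monomialCoeff-≢ : ∀ {e r} c → e ≢ r → monomialCoeff (e , c) r ≈ 0#
  monomialCoeff-≢ {e} {r} c e≢r with e ≟ r
  ... | yes e≡r = ⊥-elim (e≢r e≡r)
  ... | no  _   = refl

  coeff-∷ : ∀ t p r → coeff (t ∷ p) r ≈ monomialCoeff t r + coeff p r
  coeff-∷ (e , c) p r with e ≟ r
  ... | yes _ = refl
  ... | no  _ = sym (+-identityˡ _)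

  coeff-∑ : ∀ p r → coeff p r ≈ ∑[ t ∈ p ] monomialCoeff t r
  coeff-∑ []      r = refl
  coeff-∑ (t ∷ p) r = trans (coeff-∷ t p r) (+-congˡ (coeff-∑ p r))

  coeff-++ : ∀ p p' r → coeff (p ++ p') r ≈ coeff p r + coeff p' r
  coeff-++ p p' r = begin
    coeff (p ++ p') r                                   ≈⟨ coeff-∑ (p ++ p') r ⟩
    ∑[ t ∈ p ++ p' ] monomialCoeff t r                  ≈⟨ ∑-++ p p' _ ⟩
    ∑[ t ∈ p ] monomialCoeff t r + ∑[ t ∈ p' ] monomialCoeff t r
                                                        ≈⟨ +-cong (coeff-∑ p r) (coeff-∑ p' r) ⟨
    coeff p r + coeff p' r                              ∎

  coeff-neg : ∀ p r → coeff ([] ⊖ p) r ≈ - coeff p r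
  coeff-neg []             r = sym -0#≈0#
  coeff-neg ((e , c) ∷ p) r with e ≟ r
  ... | yes _ = trans (+-congˡ (coeff-neg p r)) (-‿+-comm c _)
  ... | no  _ = coeff-neg p r

  coeff-⊖ : ∀ p p' r → coeff (p ⊖ p') r ≈ coeff p r - coeff p' r
  coeff-⊖ p p' r = trans (coeff-++ p ([] ⊖ p') r) (+-congˡ (coeff-neg p' r))

  monomialCoeff-cong : ∀ {e e' c c' r} → e ≡ e' → c ≈ c' →
    monomialCoeff (e , c) r ≈ monomialCoeff (e' , c') r
  monomialCoeff-cong {e} {r = r} ≡.refl c≈c' with e ≟ r
  ... | yes _ = c≈c'
  ... | no  _ = refl

  monomialCoeff-shift : ∀ e e' r c c' →
    monomialCoeff (e ℚ.+ e' , c * c') r ≈ c * monomialCoeff (e' , c') (r ℚ.- e)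
  monomialCoeff-shift e e' r c c' with e ℚ.+ e' ≟ r | e' ≟ r ℚ.- e
  ... | yes _       | yes _  = refl
  ... | no  _       | no  _  = sym (zeroʳ c)
  ... | yes e+e'≡r | no e'≢  = ⊥-elim (e'≢ (≡.trans (≡.sym ([p+q]-p≡q e e')) (≡.cong (ℚ._- e) e+e'≡r)))
  ... | no e+e'≢r  | yes e'≡ = ⊥-elim (e+e'≢r (≡.trans (≡.cong (e ℚ.+_) e'≡) (p+[q-p]≡q e r)))

  coeff-·-∑∑ : ∀ p p' r →
    coeff (p · p') r ≈ ∑[ t ∈ p ] ∑[ t' ∈ p' ] monomialCoeff (proj₁ t ℚ.+ proj₁ t' , proj₂ t * proj₂ t') r
  coeff-·-∑∑ p p' r = trans (coeff-∑ (p · p') r)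
    (trans (∑-concatMap _ p _) (∑-cong p (λ t → reflexive (∑-map _ p' _))))

  coeff-·ˡ : ∀ p p' r → coeff (p · p') r ≈ ∑[ t ∈ p ] (proj₂ t * coeff p' (r ℚ.- proj₁ t))
  coeff-·ˡ p p' r = trans (coeff-·-∑∑ p p' r) (∑-cong p λ (e , c) → begin
    ∑[ t' ∈ p' ] monomialCoeff (e ℚ.+ proj₁ t' , c * proj₂ t') r
                                                ≈⟨ ∑-cong p' (λ (e' , c') → monomialCoeff-shift e e' r c c') ⟩
    ∑[ t' ∈ p' ] (c * monomialCoeff t' (r ℚ.- e))               ≈⟨ ∑-*ˡ p' c _ ⟩
    c * ∑[ t' ∈ p' ] monomialCoeff t' (r ℚ.- e)                 ≈⟨ *-congˡ (coeff-∑ p' _) ⟨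
    c * coeff p' (r ℚ.- e)                                      ∎)

  coeff-·ʳ : ∀ p p' r → coeff (p · p') r ≈ ∑[ t' ∈ p' ] (coeff p (r ℚ.- proj₁ t') * proj₂ t')
  coeff-·ʳ p p' r = trans (coeff-·-∑∑ p p' r) (trans (∑-swap p p' _) (∑-cong p' λ (e' , c') → begin
    ∑[ t ∈ p ] monomialCoeff (proj₁ t ℚ.+ e' , proj₂ t * c') r  ≈⟨ ∑-cong p (λ (e , c) → shiftʳ e e' c c') ⟩
    ∑[ t ∈ p ] (monomialCoeff t (r ℚ.- e') * c')                ≈⟨ ∑-*ʳ p c' _ ⟩
    ∑[ t ∈ p ] monomialCoeff t (r ℚ.- e') * c'                  ≈⟨ *-congʳ (coeff-∑ p _) ⟨
    coeff p (r ℚ.- e') * c'                                     ∎))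
    where
    shiftʳ : ∀ e e' c c' → monomialCoeff (e ℚ.+ e' , c * c') r ≈ monomialCoeff (e , c) (r ℚ.- e') * c'
    shiftʳ e e' c c' = begin
      monomialCoeff (e ℚ.+ e' , c * c') r   ≈⟨ monomialCoeff-cong (ℚ.+-comm e e') (*-comm c c') ⟩
      monomialCoeff (e' ℚ.+ e , c' * c) r   ≈⟨ monomialCoeff-shift e' e r c' c ⟩
      c' * monomialCoeff (e , c) (r ℚ.- e') ≈⟨ *-comm c' _ ⟩
      monomialCoeff (e , c) (r ℚ.- e') * c' ∎

  infix 4 _~_
  record _~_ (p p' : Poly) : Set where
    constructor coeffwise
    field coeff-≈ : ∀ r → coeff p r ≈ coeff p' r
  open _~_ public

  ~-refl : ∀ {p} → p ~ p
  ~-refl = coeffwise λ _ → refl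

  ~-sym : ∀ {p p'} → p ~ p' → p' ~ p
  ~-sym (coeffwise p≈p') = coeffwise λ r → sym (p≈p' r)

  ~-trans : ∀ {p p' p''} → p ~ p' → p' ~ p'' → p ~ p''
  ~-trans (coeffwise p≈p') (coeffwise p'≈p'') = coeffwise λ r → trans (p≈p' r) (p'≈p'' r)

  ~-reflexive : ∀ {p p'} → p ≡ p' → p ~ p'
  ~-reflexive ≡.refl = ~-refl

  ++-cong : ∀ {p p' q q'} → p ~ p' → q ~ q' → p ++ q ~ p' ++ q'
  ++-cong {p} {p'} {q} {q'} (coeffwise p≈p') (coeffwise q≈q') = coeffwise λ r →
    trans (coeff-++ p q r) (trans (+-cong (p≈p' r) (q≈q' r)) (sym (coeff-++ p' q' r)))

  ⊖-cong : ∀ {p p' q q'} → p ~ p' → q ~ q' → p ⊖ q ~ p' ⊖ q'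
  ⊖-cong {p} {p'} {q} {q'} (coeffwise p≈p') (coeffwise q≈q') = coeffwise λ r →
    trans (coeff-⊖ p q r) (trans (+-cong (p≈p' r) (-‿cong (q≈q' r))) (sym (coeff-⊖ p' q' r)))

  ·-congˡ : ∀ {p p'} q → p ~ p' → p · q ~ p' · q
  ·-congˡ {p} {p'} q (coeffwise p≈p') = coeffwise λ r →
    trans (coeff-·ʳ p q r) (trans (∑-cong q (λ t → *-congʳ (p≈p' _))) (sym (coeff-·ʳ p' q r)))

  ·-congʳ : ∀ p {q q'} → q ~ q' → p · q ~ p · q'
  ·-congʳ p {q} {q'} (coeffwise q≈q') = coeffwise λ r →
    trans (coeff-·ˡ p q r) (trans (∑-cong p (λ t → *-congˡ (q≈q' _))) (sym (coeff-·ˡ p q' r)))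

  ·-cong : ∀ {p p' q q'} → p ~ p' → q ~ q' → p · q ~ p' · q'
  ·-cong {p' = p'} {q = q} p~p' q~q' = ~-trans (·-congˡ q p~p') (·-congʳ p' q~q')

  ·-swapʳ : ∀ p q s → (p · q) · s ~ (p · s) · q
  ·-swapʳ p q s = coeffwise λ r → begin
    coeff ((p · q) · s) r
      ≈⟨ coeff-·ʳ (p · q) s r ⟩
    ∑[ u ∈ s ] (coeff (p · q) (r ℚ.- proj₁ u) * proj₂ u)
      ≈⟨ ∑-cong s (λ u → *-congʳ (coeff-·ʳ p q _)) ⟩
    ∑[ u ∈ s ] (∑[ t ∈ q ] (coeff p ((r ℚ.- proj₁ u) ℚ.- proj₁ t) * proj₂ t) * proj₂ u)
      ≈⟨ ∑-cong s (λ u → sym (∑-*ʳ q (proj₂ u) _)) ⟩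
    ∑[ u ∈ s ] ∑[ t ∈ q ] (coeff p ((r ℚ.- proj₁ u) ℚ.- proj₁ t) * proj₂ t * proj₂ u)
      ≈⟨ ∑-swap s q _ ⟩
    ∑[ t ∈ q ] ∑[ u ∈ s ] (coeff p ((r ℚ.- proj₁ u) ℚ.- proj₁ t) * proj₂ t * proj₂ u)
      ≈⟨ ∑-cong q (λ t → ∑-cong s (λ u → reorder r t u)) ⟩
    ∑[ t ∈ q ] ∑[ u ∈ s ] (coeff p ((r ℚ.- proj₁ t) ℚ.- proj₁ u) * proj₂ u * proj₂ t)
      ≈⟨ ∑-cong q (λ t → ∑-*ʳ s (proj₂ t) _) ⟩
    ∑[ t ∈ q ] (∑[ u ∈ s ] (coeff p ((r ℚ.- proj₁ t) ℚ.- proj₁ u) * proj₂ u) * proj₂ t)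
      ≈⟨ ∑-cong q (λ t → *-congʳ (coeff-·ʳ p s _)) ⟨
    ∑[ t ∈ q ] (coeff (p · s) (r ℚ.- proj₁ t) * proj₂ t)
      ≈⟨ coeff-·ʳ (p · s) q r ⟨
    coeff ((p · s) · q) r ∎
    where
    open import Algebra.Properties.CommutativeSemigroup *-commutativeSemigroup using (xy∙z≈xz∙y)
    reorder : ∀ r t u → coeff p ((r ℚ.- proj₁ u) ℚ.- proj₁ t) * proj₂ t * proj₂ u
                      ≈ coeff p ((r ℚ.- proj₁ t) ℚ.- proj₁ u) * proj₂ u * proj₂ t
    reorder r t u = trans (reflexive (≡.cong (λ e → coeff p e * proj₂ t * proj₂ u) ([r-p]-q≡[r-q]-p r _ _)))
                        (xy∙z≈xz∙y _ _ _)

  ·-distribʳ-++ : ∀ p q s → (p ++ q) · s ≡ (p · s) ++ (q · s)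
  ·-distribʳ-++ p q s = concatMap-++ _ p q

  neg-· : ∀ p s → ([] ⊖ p) · s ~ [] ⊖ (p · s)
  neg-· p s = coeffwise λ r → begin
    coeff (([] ⊖ p) · s) r                                ≈⟨ coeff-·ˡ ([] ⊖ p) s r ⟩
    ∑[ t ∈ [] ⊖ p ] (proj₂ t * coeff s (r ℚ.- proj₁ t))   ≡⟨ ∑-map _ p _ ⟩
    ∑[ t ∈ p ] (- proj₂ t * coeff s (r ℚ.- proj₁ t))      ≈⟨ ∑-cong p (λ t → sym (-‿distribˡ-* (proj₂ t) _)) ⟩
    ∑[ t ∈ p ] (- (proj₂ t * coeff s (r ℚ.- proj₁ t)))    ≈⟨ ∑-neg p _ ⟩
    - ∑[ t ∈ p ] (proj₂ t * coeff s (r ℚ.- proj₁ t))      ≈⟨ -‿cong (coeff-·ˡ p s r) ⟨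
    - coeff (p · s) r                                     ≈⟨ coeff-neg (p · s) r ⟨
    coeff ([] ⊖ (p · s)) r                                ∎

  ·-distribʳ-⊖ : ∀ p q s → (p ⊖ q) · s ~ (p · s) ⊖ (q · s)
  ·-distribʳ-⊖ p q s =
    ~-trans (~-reflexive (·-distribʳ-++ p ([] ⊖ q) s)) (++-cong (~-refl {p · s}) (neg-· q s))

  ~-setoid : Setoid 0ℓ 0ℓ
  ~-setoid = record
    { Carrier = Poly
    ; _≈_ = _~_
    ; isEquivalence = record { refl = ~-refl ; sym = ~-sym ; trans = ~-trans }
    }

  ⊖-cancel : ∀ {p p'} → p ~ p' → ∀ r → coeff (p ⊖ p') r ≈ 0#
  ⊖-cancel {p} {p'} (coeffwise p≈p') r = trans (coeff-⊖ p p' r) (trans (+-congʳ (p≈p' r)) (-‿inverseʳ _))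

  ⊖-flip : ∀ p q → q ⊖ p ~ [] ⊖ (p ⊖ q)
  ⊖-flip p q = coeffwise λ r → begin
    coeff (q ⊖ p) r                  ≈⟨ coeff-⊖ q p r ⟩
    coeff q r - coeff p r            ≈⟨ +-comm _ _ ⟩
    - coeff p r + coeff q r          ≈⟨ +-congˡ (-‿involutive _) ⟨
    - coeff p r + - (- coeff q r)    ≈⟨ -‿+-comm _ _ ⟩
    - (coeff p r - coeff q r)        ≈⟨ -‿cong (coeff-⊖ p q r) ⟨
    - coeff (p ⊖ q) r                ≈⟨ coeff-neg (p ⊖ q) r ⟨
    coeff ([] ⊖ (p ⊖ q)) r           ∎

  ⊖-telescope : ∀ p q s → p ⊖ q ~ (p ⊖ s) ++ (s ⊖ q)
  ⊖-telescope p q s = coeffwise λ r → begin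
    coeff (p ⊖ q) r                                  ≈⟨ coeff-⊖ p q r ⟩
    coeff p r - coeff q r                            ≈⟨ +-congʳ (+-identityʳ _) ⟨
    (coeff p r + 0#) - coeff q r                     ≈⟨ +-congʳ (+-congˡ (-‿inverseˡ (coeff s r))) ⟨
    (coeff p r + (- coeff s r + coeff s r)) - coeff q r ≈⟨ +-congʳ (+-assoc _ _ _) ⟨
    ((coeff p r - coeff s r) + coeff s r) - coeff q r ≈⟨ +-assoc _ _ _ ⟩
    (coeff p r - coeff s r) + (coeff s r - coeff q r) ≈⟨ +-cong (coeff-⊖ p s r) (coeff-⊖ s q r) ⟨
    coeff (p ⊖ s) r + coeff (s ⊖ q) r                ≈⟨ coeff-++ (p ⊖ s) (s ⊖ q) r ⟨
    coeff ((p ⊖ s) ++ (s ⊖ q)) r                     ∎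

  ++-⊖-comm : ∀ p q s → (p ++ s) ⊖ q ~ (p ⊖ q) ++ s
  ++-⊖-comm p q s = coeffwise λ r → begin
    coeff ((p ++ s) ⊖ q) r               ≈⟨ coeff-⊖ (p ++ s) q r ⟩
    coeff (p ++ s) r - coeff q r         ≈⟨ +-congʳ (coeff-++ p s r) ⟩
    (coeff p r + coeff s r) - coeff q r  ≈⟨ xy∙z≈xz∙y _ _ _ ⟩
    (coeff p r - coeff q r) + coeff s r  ≈⟨ +-congʳ (coeff-⊖ p q r) ⟨
    coeff (p ⊖ q) r + coeff s r          ≈⟨ coeff-++ (p ⊖ q) s r ⟨
    coeff ((p ⊖ q) ++ s) r               ∎
    where open import Algebra.Properties.CommutativeSemigroup +-commutativeSemigroup using (xy∙z≈xz∙y)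

NoZeroDivisors : CommutativeRing 0ℓ 0ℓ → Set
NoZeroDivisors R = ∀ {x y} → ¬ x ≈ 0# → ¬ y ≈ 0# → ¬ x * y ≈ 0#
  where open CommutativeRing R

module SeriesOrder (R : CommutativeRing 0ℓ 0ℓ) where
  open CommutativeRing R renaming (Carrier to K)
  open Series R
  open ListSum R
  open SeriesArithmetic R
  open import Relation.Binary.Reasoning.Setoid setoid

  VanishesBelow : Poly → Maybe ℚ → Set
  VanishesBelow p w = ∀ r → just r <∞ w → coeff p r ≈ 0#

  IsVal⇒VanishesBelow : ∀ p w → IsVal p w → VanishesBelow p w
  IsVal⇒VanishesBelow p nothing  p≈0       r _ = p≈0 r
  IsVal⇒VanishesBelow p (just a) (_ , low) r   = low r

  IsVal-~ : ∀ {p p'} w → p ~ p' → IsVal p w → IsVal p' w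
  IsVal-~ nothing  (coeffwise p≈p') p≈0 r = trans (sym (p≈p' r)) (p≈0 r)
  IsVal-~ (just a) (coeffwise p≈p') (lead≉0 , low) =
    (λ lead≈0 → lead≉0 (trans (p≈p' a) lead≈0)) , (λ r r<a → trans (sym (p≈p' r)) (low r r<a))

  IsVal-unique : ∀ p {w w'} → IsVal p w → IsVal p w' → w ≡ w'
  IsVal-unique p {nothing} {nothing}  _               _                = ≡.refl
  IsVal-unique p {nothing} {just b}   p≈0             (lead≉0 , _)     = ⊥-elim (lead≉0 (p≈0 b))
  IsVal-unique p {just a}  {nothing}  (lead≉0 , _)    p≈0              = ⊥-elim (lead≉0 (p≈0 a))
  IsVal-unique p {just a}  {just b}   (lead≉0 , low)  (lead'≉0 , low') with ℚ.<-cmp a b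
  ... | tri< a<b _ _ = ⊥-elim (lead≉0 (low' a a<b))
  ... | tri≈ _ a≡b _ = ≡.cong just a≡b
  ... | tri> _ _ a>b = ⊥-elim (lead'≉0 (low b a>b))

  truncate : ℚ → Poly → Poly
  truncate a = filter (λ t → a ≤? proj₁ t)

  truncate-accept : ∀ {a t} p → a ≤ proj₁ t → truncate a (t ∷ p) ≡ t ∷ truncate a p
  truncate-accept {a} p = filter-accept (λ t → a ≤? proj₁ t)

  truncate-reject : ∀ {a t} p → ¬ a ≤ proj₁ t → truncate a (t ∷ p) ≡ truncate a p
  truncate-reject {a} p = filter-reject (λ t → a ≤? proj₁ t)

  coeff-truncate-≥ : ∀ {a r} p → a ≤ r → coeff (truncate a p) r ≈ coeff p r
  coeff-truncate-≥ [] a≤r = refl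
  coeff-truncate-≥ {a} {r} (t ∷ p) a≤r with a ≤? proj₁ t
  ... | yes a≤e = begin
    coeff (truncate a (t ∷ p)) r            ≡⟨ ≡.cong (λ l → coeff l r) (truncate-accept p a≤e) ⟩
    coeff (t ∷ truncate a p) r              ≈⟨ coeff-∷ t (truncate a p) r ⟩
    monomialCoeff t r + coeff (truncate a p) r ≈⟨ +-congˡ (coeff-truncate-≥ p a≤r) ⟩
    monomialCoeff t r + coeff p r           ≈⟨ coeff-∷ t p r ⟨
    coeff (t ∷ p) r                         ∎
  ... | no a≰e = begin
    coeff (truncate a (t ∷ p)) r            ≡⟨ ≡.cong (λ l → coeff l r) (truncate-reject p a≰e) ⟩
    coeff (truncate a p) r                  ≈⟨ coeff-truncate-≥ p a≤r ⟩
    coeff p r                               ≈⟨ +-identityˡ _ ⟨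
    0# + coeff p r                          ≈⟨ +-congʳ (monomialCoeff-≢ (proj₂ t) e≢r) ⟨
    monomialCoeff t r + coeff p r           ≈⟨ coeff-∷ t p r ⟨
    coeff (t ∷ p) r                         ∎
    where
    e≢r : proj₁ t ≢ r
    e≢r e≡r = a≰e (ℚ.≤-trans a≤r (ℚ.≤-reflexive (≡.sym e≡r)))

  coeff-truncate-< : ∀ {a r} p → r < a → coeff (truncate a p) r ≈ 0#
  coeff-truncate-< [] r<a = refl
  coeff-truncate-< {a} {r} (t ∷ p) r<a with a ≤? proj₁ t
  ... | yes a≤e = begin
    coeff (truncate a (t ∷ p)) r            ≡⟨ ≡.cong (λ l → coeff l r) (truncate-accept p a≤e) ⟩
    coeff (t ∷ truncate a p) r              ≈⟨ coeff-∷ t (truncate a p) r ⟩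
    monomialCoeff t r + coeff (truncate a p) r ≈⟨ +-cong (monomialCoeff-≢ (proj₂ t) e≢r) (coeff-truncate-< p r<a) ⟩
    0# + 0#                                 ≈⟨ +-identityˡ 0# ⟩
    0#                                      ∎
    where
    e≢r : proj₁ t ≢ r
    e≢r e≡r = ℚ.<-irrefl ≡.refl (ℚ.<-≤-trans r<a (ℚ.≤-trans a≤e (ℚ.≤-reflexive e≡r)))
  ... | no a≰e = trans (reflexive (≡.cong (λ l → coeff l r) (truncate-reject p a≰e))) (coeff-truncate-< p r<a)

  truncate-~ : ∀ {a} p → VanishesBelow p (just a) → truncate a p ~ p
  truncate-~ {a} p low = coeffwise λ r → case r
    where
    case : ∀ r → coeff (truncate a p) r ≈ coeff p r
    case r with ℚ.<-cmp r a
    ... | tri< r<a _ _ = trans (coeff-truncate-< p r<a) (sym (low r r<a))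
    ... | tri≈ _ r≡a _ = coeff-truncate-≥ p (ℚ.≤-reflexive (≡.sym r≡a))
    ... | tri> _ _ r>a = coeff-truncate-≥ p (ℚ.<⇒≤ r>a)

  ∈-truncate⇒≤ : ∀ {a t} p → t ∈ truncate a p → a ≤ proj₁ t
  ∈-truncate⇒≤ {a} p t∈ = proj₂ (∈-filter⁻ (λ t → a ≤? proj₁ t) {xs = p} t∈)

  ·-vanishesBelow : ∀ p q w {b} → VanishesBelow p w → VanishesBelow q (just b) →
    VanishesBelow (p · q) (w +∞ b)
  ·-vanishesBelow p q nothing p≈0 _ r _ = begin
    coeff (p · q) r                                   ≈⟨ coeff-·ʳ p q r ⟩
    ∑[ t' ∈ q ] (coeff p (r ℚ.- proj₁ t') * proj₂ t') ≈⟨ ∑-cong q (λ t' → trans (*-congʳ (p≈0 _ tt)) (zeroˡ _)) ⟩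
    ∑[ t' ∈ q ] 0#                                    ≈⟨ ∑-zero q ⟩
    0#                                                ∎
  ·-vanishesBelow p q (just a) {b} p-low q-low r r<a+b = begin
    coeff (p · q) r                                   ≈⟨ coeff-≈ (·-congˡ q (truncate-~ p p-low)) r ⟨
    coeff (truncate a p · q) r                        ≈⟨ coeff-·ˡ (truncate a p) q r ⟩
    ∑[ t ∈ truncate a p ] (proj₂ t * coeff q (r ℚ.- proj₁ t))
      ≈⟨ ∑-cong-∈ (truncate a p) (λ t∈ → trans (*-congˡ (q-low _ (r-e<b t∈))) (zeroʳ _)) ⟩
    ∑[ t ∈ truncate a p ] 0#                          ≈⟨ ∑-zero (truncate a p) ⟩
    0#                                                ∎
    where
    r-e<b : ∀ {t} → t ∈ truncate a p → r ℚ.- proj₁ t < b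
    r-e<b t∈ = r<a+b⇒r-e<b r<a+b (∈-truncate⇒≤ p t∈)

  coeff-·-lowest : ∀ p q {a b} → VanishesBelow p (just a) → VanishesBelow q (just b) →
    coeff (p · q) (a ℚ.+ b) ≈ coeff p a * coeff q b
  coeff-·-lowest p q {a} {b} p-low q-low = begin
    coeff (p · q) (a ℚ.+ b)                                          ≈⟨ coeff-≈ (·-congˡ q (truncate-~ p p-low)) _ ⟨
    coeff (truncate a p · q) (a ℚ.+ b)                               ≈⟨ coeff-·ˡ (truncate a p) q _ ⟩
    ∑[ t ∈ truncate a p ] (proj₂ t * coeff q ((a ℚ.+ b) ℚ.- proj₁ t)) ≈⟨ ∑-cong-∈ (truncate a p) term ⟩
    ∑[ t ∈ truncate a p ] (monomialCoeff t a * coeff q b)            ≈⟨ ∑-*ʳ (truncate a p) _ _ ⟩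
    ∑[ t ∈ truncate a p ] monomialCoeff t a * coeff q b              ≈⟨ *-congʳ (coeff-∑ (truncate a p) a) ⟨
    coeff (truncate a p) a * coeff q b                               ≈⟨ *-congʳ (coeff-≈ (truncate-~ p p-low) a) ⟩
    coeff p a * coeff q b                                            ∎
    where
    term : ∀ {t} → t ∈ truncate a p →
      proj₂ t * coeff q ((a ℚ.+ b) ℚ.- proj₁ t) ≈ monomialCoeff t a * coeff q b
    term {e , c} t∈ with e ≟ a
    ... | yes ≡.refl = *-congˡ (reflexive (≡.cong (coeff q) ([p+q]-p≡q e b)))
    ... | no  e≢a    = trans (*-congˡ (q-low _ a+b-e<b)) (trans (zeroʳ c) (sym (zeroˡ _)))
      where
      a<e : a < e
      a<e = ≤∧≢⇒< (∈-truncate⇒≤ p t∈) (e≢a ∘ ≡.sym)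
      a+b-e<b : (a ℚ.+ b) ℚ.- e < b
      a+b-e<b =
        ≡.subst ((a ℚ.+ b) ℚ.- e <_) ([p+q]-p≡q a b) (ℚ.+-monoʳ-< (a ℚ.+ b) (ℚ.neg-antimono-< a<e))

  module Domain (no-zero-divisors : NoZeroDivisors R) where

    IsVal-· : ∀ p q {a b} → IsVal p (just a) → IsVal q (just b) → IsVal (p · q) (just (a ℚ.+ b))
    IsVal-· p q {a} {b} p-val@(p-lead≉0 , _) q-val@(q-lead≉0 , _) =
      (λ lead≈0 → no-zero-divisors p-lead≉0 q-lead≉0
                    (trans (sym (coeff-·-lowest p q p-low q-low)) lead≈0)) ,
      ·-vanishesBelow p q (just a) p-low q-low
      where
      p-low = IsVal⇒VanishesBelow p (just a) p-val
      q-low = IsVal⇒VanishesBelow q (just b) q-val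

module SeriesValuation (R : CommutativeRing 0ℓ 0ℓ) (_≈?_ : Decidable (CommutativeRing._≈_ R)) where
  open CommutativeRing R renaming (Carrier to K)
  open Series R
  open SeriesArithmetic R
  open SeriesOrder R hiding (module Domain)
  open import Relation.Binary.Reasoning.Setoid setoid
  open Data.List.Extrema (DecTotalOrder.totalOrder ℚ.≤-decTotalOrder) using (min; min≤⊤; min≤xs; argmin-sel)

  support : Poly → List ℚ
  support p = filter (λ e → ¬? (coeff p e ≈? 0#)) (map proj₁ p)

  nonzero⇒∈exponents : ∀ p {r} → ¬ coeff p r ≈ 0# → r ∈ map proj₁ p
  nonzero⇒∈exponents []            nz = ⊥-elim (nz refl)
  nonzero⇒∈exponents ((e , c) ∷ p) {r} nz with e ≟ r
  ... | yes e≡r = here (≡.sym e≡r)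
  ... | no  _   = there (nonzero⇒∈exponents p nz)

  nonzero⇒∈support : ∀ p {r} → ¬ coeff p r ≈ 0# → r ∈ support p
  nonzero⇒∈support p nz = ∈-filter⁺ (λ e → ¬? (coeff p e ≈? 0#)) (nonzero⇒∈exponents p nz) nz

  ∈support⇒nonzero : ∀ p {r} → r ∈ support p → ¬ coeff p r ≈ 0#
  ∈support⇒nonzero p r∈ = proj₂ (∈-filter⁻ (λ e → ¬? (coeff p e ≈? 0#)) {xs = map proj₁ p} r∈)

  min∈ : ∀ e es → min e es ∈ e ∷ es
  min∈ e es = [ here , there ]′ (argmin-sel id e es)

  min≤ : ∀ e es {y} → y ∈ e ∷ es → min e es ≤ y
  min≤ e es (here ≡.refl) = min≤⊤ e es
  min≤ e es (there y∈)    = All.lookup (min≤xs e es) y∈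

  valuation : ∀ p → Σ (Maybe ℚ) (IsVal p)
  valuation p with support p | nonzero⇒∈support p | ∈support⇒nonzero p
  ... | []     | ∈supp | _ = nothing , λ r → decidable-stable (coeff p r ≈? 0#) (λ nz → ∉[] (∈supp nz))
    where
    ∉[] : ∀ {r : ℚ} → ¬ r ∈ []
    ∉[] ()
  ... | e ∷ es | ∈supp | supp⇒nz = just (min e es) , supp⇒nz (min∈ e es) , λ r r<m →
    decidable-stable (coeff p r ≈? 0#) (λ nz → ℚ.<-irrefl ≡.refl (ℚ.<-≤-trans r<m (min≤ e es (∈supp nz))))

  val : Poly → Maybe ℚ
  val p = proj₁ (valuation p)

  val-isVal : ∀ p → IsVal p (val p)
  val-isVal p = proj₂ (valuation p)

  val-unique : ∀ p {w} → IsVal p w → val p ≡ w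
  val-unique p = IsVal-unique p (val-isVal p)

  val-~ : ∀ {p p'} → p ~ p' → val p ≡ val p'
  val-~ {p} {p'} p~p' = ≡.sym (val-unique p' (IsVal-~ (val p) p~p' (val-isVal p)))

  coeff-++-zero : ∀ p q {r} → coeff p r ≈ 0# → coeff q r ≈ 0# → coeff (p ++ q) r ≈ 0#
  coeff-++-zero p q {r} p≈0 q≈0 = trans (coeff-++ p q r) (trans (+-cong p≈0 q≈0) (+-identityˡ 0#))

  vanishesBelow⇒≤val : ∀ p w → VanishesBelow p w → w ≤∞ val p
  vanishesBelow⇒≤val p w low with val p | val-isVal p
  ... | nothing | _                = tt
  vanishesBelow⇒≤val p nothing  low | just c | (lead≉0 , _) = lead≉0 (low c tt)
  vanishesBelow⇒≤val p (just s) low | just c | (lead≉0 , _) = ℚ.≮⇒≥ (λ c<s → lead≉0 (low c c<s))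

  val-++ : ∀ p q → val p ⊓∞ val q ≤∞ val (p ++ q)
  val-++ p q = vanishesBelow⇒≤val (p ++ q) (val p ⊓∞ val q) λ r r<m →
    coeff-++-zero p q
      (IsVal⇒VanishesBelow p (val p) (val-isVal p) r (<∞-≤∞-trans r<m (⊓∞-≤ˡ (val p) (val q))))
      (IsVal⇒VanishesBelow q (val q) (val-isVal q) r (<∞-≤∞-trans r<m (⊓∞-≤ʳ (val p) (val q))))

  val-++-exact : ∀ p q {b} → IsVal q (just b) → ¬ coeff (p ++ q) b ≈ 0# → val (p ++ q) ≡ val p ⊓∞ just b
  val-++-exact p q {b} (_ , q-low) nz with val p | val-isVal p
  ... | nothing | p≈0 = val-unique (p ++ q) (nz , λ r r<b → coeff-++-zero p q (p≈0 r) (q-low r r<b))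
  ... | just a  | (p-lead≉0 , p-low) with a ℚ.<? b
  ...   | yes a<b =
    ≡.trans (val-unique (p ++ q) (lead≉0 , low)) (≡.cong just (≡.sym (ℚ.p≤q⇒p⊓q≡p (ℚ.<⇒≤ a<b))))
    where
    lead≉0 : ¬ coeff (p ++ q) a ≈ 0#
    lead≉0 lead≈0 = p-lead≉0 (begin
      coeff p a                ≈⟨ +-identityʳ _ ⟨
      coeff p a + 0#           ≈⟨ +-congˡ (q-low a a<b) ⟨
      coeff p a + coeff q a    ≈⟨ coeff-++ p q a ⟨
      coeff (p ++ q) a         ≈⟨ lead≈0 ⟩
      0#                       ∎)
    low : ∀ r → r < a → coeff (p ++ q) r ≈ 0#
    low r r<a = coeff-++-zero p q (p-low r r<a) (q-low r (ℚ.<-trans r<a a<b))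
  ...   | no a≮b =
    ≡.trans (val-unique (p ++ q) (nz , low)) (≡.cong just (≡.sym (ℚ.p≥q⇒p⊓q≡q (ℚ.≮⇒≥ a≮b))))
    where
    low : ∀ r → r < b → coeff (p ++ q) r ≈ 0#
    low r r<b = coeff-++-zero p q (p-low r (ℚ.<-≤-trans r<b (ℚ.≮⇒≥ a≮b))) (q-low r r<b)

  val-neg : ∀ p → val ([] ⊖ p) ≡ val p
  val-neg p = val-unique ([] ⊖ p) (neg-isVal (val p) (val-isVal p))
    where
    open import Algebra.Properties.Ring ring using (-0#≈0#; -‿involutive)
    neg≈0 : ∀ {r} → coeff p r ≈ 0# → coeff ([] ⊖ p) r ≈ 0#
    neg≈0 {r} p≈0 = trans (coeff-neg p r) (trans (-‿cong p≈0) -0#≈0#)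
    neg-isVal : ∀ w → IsVal p w → IsVal ([] ⊖ p) w
    neg-isVal nothing  p≈0 r = neg≈0 (p≈0 r)
    neg-isVal (just a) (lead≉0 , low) =
      (λ neg≈0′ → lead≉0 (trans (sym (-‿involutive _))
                            (trans (-‿cong (trans (sym (coeff-neg p a)) neg≈0′)) -0#≈0#))) ,
      (λ r r<a → neg≈0 (low r r<a))

  module Domain (no-zero-divisors : NoZeroDivisors R) where

    val-·ʳ : ∀ p q {b} → IsVal q (just b) → val (p · q) ≡ val p +∞ b
    val-·ʳ p q {b} q-val with val p | val-isVal p
    ... | nothing | p≈0 = val-unique (p · q) λ r →
      ·-vanishesBelow p q nothing (λ r _ → p≈0 r) (IsVal⇒VanishesBelow q (just b) q-val) r tt
    ... | just a  | p-val = val-unique (p · q) (IsVal-· p q p-val q-val)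
      where open SeriesOrder.Domain R no-zero-divisors using (IsVal-·)

Enumerates : {A : Set} → (ℕ → A) → Set
Enumerates {A} e = ∀ a → ∃ λ k → e k ≡ a

-- Walks the antidiagonals a + b = s from (0 , s) to (s , 0).
nextPair : ℕ × ℕ → ℕ × ℕ
nextPair (a , zero)  = zero , suc a
nextPair (a , suc b) = suc a , b

unpair : ℕ → ℕ × ℕ
unpair zero    = 0 , 0
unpair (suc n) = nextPair (unpair n)

unpair-reaches : ∀ s a b → a ℕ.+ b ≡ s → ∃ λ n → unpair n ≡ (a , b)
unpair-reaches s       zero    zero    _   = 0 , ≡.refl
unpair-reaches (suc s) zero    (suc b) b+1≡s+1
  with n , eq ← unpair-reaches s b zero (≡.trans (ℕ.+-identityʳ b) (ℕ.suc-injective b+1≡s+1))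
  = suc n , ≡.cong nextPair eq
unpair-reaches s       (suc a) b       a+1+b≡s
  with n , eq ← unpair-reaches s a (suc b) (≡.trans (ℕ.+-suc a b) a+1+b≡s)
  = suc n , ≡.cong nextPair eq

unpair-enumerates : Enumerates unpair
unpair-enumerates (a , b) = unpair-reaches (a ℕ.+ b) a b ≡.refl

private variable A B : Set

unpair-hits : ∀ (f : ℕ → ℕ → A) i j → ∃ λ k → f (proj₁ (unpair k)) (proj₂ (unpair k)) ≡ f i j
unpair-hits f i j with k , unpair-k≡ij ← unpair-enumerates (i , j)
  = k , ≡.cong (λ ij → f (proj₁ ij) (proj₂ ij)) unpair-k≡ij

_⊗_ : (ℕ → A) → (ℕ → B) → ℕ → A × B
(e ⊗ e') k = e (proj₁ (unpair k)) , e' (proj₂ (unpair k))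

⊗-enumerates : {e : ℕ → A} {e' : ℕ → B} → Enumerates e → Enumerates e' → Enumerates (e ⊗ e')
⊗-enumerates {e = e} {e'} e-onto e'-onto (a , b)
  with i , ei≡a ← e-onto a | j , e'j≡b ← e'-onto b
  with k , hit ← unpair-hits (λ i j → e i , e' j) i j
  = k , ≡.trans hit (≡.cong₂ _,_ ei≡a e'j≡b)

enumℤ : ℕ → ℤ
enumℤ k = proj₁ (unpair k) ℤ.⊖ proj₂ (unpair k)

enumℤ-enumerates : Enumerates enumℤ
enumℤ-enumerates (ℤ.+ n)    = unpair-hits ℤ._⊖_ n 0
enumℤ-enumerates ℤ.-[1+ n ] = unpair-hits ℤ._⊖_ 0 (suc n)

enumℚ : ℕ → ℚ
enumℚ k = enumℤ (proj₁ (unpair k)) ℚ./ suc (proj₂ (unpair k))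

enumℚ-enumerates : Enumerates enumℚ
enumℚ-enumerates q@(mkℚ z d _)
  with i , enumℤ-i≡z ← enumℤ-enumerates z
  with k , hit ← unpair-hits (λ i j → enumℤ i ℚ./ suc j) i d
  = k , ≡.trans hit (≡.trans (≡.cong (ℚ._/ suc d) enumℤ-i≡z) (ℚ.↥p/↧p≡p q))

decodeList : (ℕ → A) → ℕ → ℕ → List A
decodeList e zero    c = []
decodeList e (suc n) c = e (proj₁ (unpair c)) ∷ decodeList e n (proj₂ (unpair c))

decodeList-onto : {e : ℕ → A} → Enumerates e → ∀ xs → ∃ λ c → decodeList e (length xs) c ≡ xs
decodeList-onto e-onto []       = 0 , ≡.refl
decodeList-onto {e = e} e-onto (x ∷ xs)
  with i , ei≡x ← e-onto x | j , decode-j≡xs ← decodeList-onto e-onto xs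
  with k , hit ← unpair-hits (λ i j → e i ∷ decodeList e (length xs) j) i j
  = k , ≡.trans hit (≡.cong₂ _∷_ ei≡x decode-j≡xs)

enumList : (ℕ → A) → ℕ → List A
enumList e k = decodeList e (proj₁ (unpair k)) (proj₂ (unpair k))

enumList-enumerates : {e : ℕ → A} → Enumerates e → Enumerates (enumList e)
enumList-enumerates {e = e} e-onto xs
  with c , decode-c≡xs ← decodeList-onto e-onto xs
  with k , hit ← unpair-hits (decodeList e) (length xs) c
  = k , ≡.trans hit decode-c≡xs

upper-bound : ∀ {n} (f : Fin n → ℕ) → ∃ λ M → ∀ j → f j ℕ.< M
upper-bound {zero}  f = 0 , λ ()
upper-bound {suc n} f = suc (f zero) ℕ.⊔ M , bound
  where
  M = proj₁ (upper-bound (f ∘ suc))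
  bound : ∀ j → f j ℕ.< suc (f zero) ℕ.⊔ M
  bound zero    = ℕ.m≤m⊔n _ M
  bound (suc j) = ℕ.<-≤-trans (proj₂ (upper-bound (f ∘ suc)) j) (ℕ.m≤n⊔m _ M)

module CountablyInfiniteRing (R : CommutativeRing 0ℓ 0ℓ) (countable : CountablyInfinite R) where
  open CommutativeRing R renaming (Carrier to K)
  open Bijection countable public using () renaming (to to toℕ)
  open Bijection countable using (surjective; injective) renaming (cong to toℕ-cong)

  _≈?_ : Decidable _≈_
  x ≈? y = Dec.map′ injective toℕ-cong (toℕ x ℕ.≟ toℕ y)

  fromℕ : ℕ → K
  fromℕ k = proj₁ (surjective k)

  toℕ-fromℕ : ∀ k → toℕ (fromℕ k) ≡ k
  toℕ-fromℕ k = proj₂ (surjective k) refl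

  fromℕ-toℕ : ∀ c → fromℕ (toℕ c) ≈ c
  fromℕ-toℕ c = injective (toℕ-fromℕ (toℕ c))

  fresh : ∀ {n} (xs : Fin n → K) → ∃ λ c → ∀ j → ¬ c ≈ xs j
  fresh xs = fromℕ M , λ j c≈xs → ℕ.<-irrefl (≡.trans (≡.sym (toℕ-cong c≈xs)) (toℕ-fromℕ M)) (bound j)
    where
    M = proj₁ (upper-bound (toℕ ∘ xs))
    bound = proj₂ (upper-bound (toℕ ∘ xs))

module FieldFacts (R : CommutativeRing 0ℓ 0ℓ) (isField : IsField R) where
  open CommutativeRing R renaming (Carrier to K)
  open import Relation.Binary.Reasoning.Setoid setoid

  no-zero-divisors : NoZeroDivisors R
  no-zero-divisors {x} {y} x≉0 y≉0 xy≈0 = y≉0 (begin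
    y             ≈⟨ *-identityˡ y ⟨
    1# * y        ≈⟨ *-congʳ x⁻¹x≈1 ⟨
    (x⁻¹ * x) * y ≈⟨ *-assoc x⁻¹ x y ⟩
    x⁻¹ * (x * y) ≈⟨ *-congˡ xy≈0 ⟩
    x⁻¹ * 0#      ≈⟨ zeroʳ x⁻¹ ⟩
    0#            ∎)
    where
    x⁻¹ = proj₁ (proj₂ isField x x≉0)
    x⁻¹x≈1 = trans (*-comm x⁻¹ x) (proj₂ (proj₂ isField x x≉0))

  linear-root : ∀ {a l l⁻¹ c} → l * l⁻¹ ≈ 1# → a + c * l ≈ 0# → c ≈ - a * l⁻¹
  linear-root {a} {l} {l⁻¹} {c} ll⁻¹≈1 a+cl≈0 = begin
    c               ≈⟨ *-identityʳ c ⟨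
    c * 1#          ≈⟨ *-congˡ ll⁻¹≈1 ⟨
    c * (l * l⁻¹)   ≈⟨ *-assoc c l l⁻¹ ⟨
    (c * l) * l⁻¹   ≈⟨ *-congʳ cl≈-a ⟩
    - a * l⁻¹       ∎
    where
    cl≈-a : c * l ≈ - a
    cl≈-a = begin
      c * l              ≈⟨ +-identityˡ _ ⟨
      0# + c * l         ≈⟨ +-congʳ (-‿inverseˡ a) ⟨
      (- a + a) + c * l  ≈⟨ +-assoc _ _ _ ⟩
      - a + (a + c * l)  ≈⟨ +-congˡ a+cl≈0 ⟩
      - a + 0#           ≈⟨ +-identityʳ _ ⟩
      - a                ∎

-- The valuation distance on k(t^ℚ)

module FractionDistance (R : CommutativeRing 0ℓ 0ℓ) (isField : IsField R) (countable : CountablyInfinite R) where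
  open CommutativeRing R renaming (Carrier to K)
  open Series R
  open SeriesArithmetic R
  open SeriesOrder R
  open CountablyInfiniteRing R countable using (_≈?_; fresh; toℕ; fromℕ; fromℕ-toℕ)
  open SeriesValuation R _≈?_
  open FieldFacts R isField
  open SeriesOrder.Domain R no-zero-divisors
  open SeriesValuation.Domain R _≈?_ no-zero-divisors
  open Frac

  finiteVal : ∀ p → ¬ (∀ q → coeff p q ≈ 0#) → Σ ℚ λ a → IsVal p (just a)
  finiteVal p p≉0 with val p | val-isVal p
  ... | nothing | p≈0   = ⊥-elim (p≉0 p≈0)
  ... | just a  | p-val = a , p-val

  denVal : Frac → ℚ
  denVal x = proj₁ (finiteVal (den x) (den≢0 x))

  denVal-isVal : ∀ x → IsVal (den x) (just (denVal x))
  denVal-isVal x = proj₂ (finiteVal (den x) (den≢0 x))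

  numDiff : Frac → Frac → Poly
  numDiff x y = (num x · den y) ⊖ (num y · den x)

  -- v(x - y) = v(num (x - y)) - v(den (x - y)), for x - y = numDiff x y / (den x · den y).
  valDiff : Frac → Frac → Maybe ℚ
  valDiff x y = val (numDiff x y) +∞ ℚ.- (denVal x ℚ.+ denVal y)

  valDiff-correct : ∀ x y w → Series.IsValDiff R x y w → valDiff x y ≡ w
  valDiff-correct x y w (wn , wd , numDiff-val , Dn-val , w≡) = ≡.trans
    (≡.cong₂ (λ n d → n +∞ ℚ.- d) (val-unique (numDiff x y) numDiff-val)
      (just-injective (IsVal-unique (den x · den y) Dn-denVal Dn-val)))
    (≡.sym w≡)
    where Dn-denVal = IsVal-· (den x) (den y) (denVal-isVal x) (denVal-isVal y)

  _≃_ : Frac → Frac → Set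
  x ≃ y = num x ~ num y × den x ~ den y

  valDiff-≃ : ∀ {x y} → x ≃ y → valDiff x y ≡ nothing
  valDiff-≃ {x} {y} (num≃ , den≃) =
    ≡.cong (_+∞ ℚ.- (denVal x ℚ.+ denVal y))
      (val-unique (numDiff x y) (⊖-cancel (·-cong num≃ (~-sym den≃))))

  valDiff-sym : ∀ x y → valDiff x y ≡ valDiff y x
  valDiff-sym x y = ≡.cong₂ (λ n d → n +∞ ℚ.- d)
    (≡.sym (≡.trans (val-~ (⊖-flip (num x · den y) (num y · den x))) (val-neg (numDiff x y))))
    (ℚ.+-comm (denVal x) (denVal y))

  numDiff-cocycle : ∀ x y z → numDiff x z · den y ~ (numDiff x y · den z) ++ (numDiff y z · den x)
  numDiff-cocycle x y z = begin
    ((a · g) ⊖ (e · b)) · d                                   ≈⟨ ·-distribʳ-⊖ (a · g) (e · b) d ⟩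
    ((a · g) · d) ⊖ ((e · b) · d)                             ≈⟨ ⊖-cong (·-swapʳ a g d) (·-swapʳ e b d) ⟩
    ((a · d) · g) ⊖ ((e · d) · b)
      ≈⟨ ⊖-telescope ((a · d) · g) ((e · d) · b) ((c · g) · b) ⟩
    (((a · d) · g) ⊖ ((c · g) · b)) ++ (((c · g) · b) ⊖ ((e · d) · b))
      ≈⟨ ++-cong (⊖-cong (~-refl {(a · d) · g}) (·-swapʳ c g b))
                 (~-refl {((c · g) · b) ⊖ ((e · d) · b)}) ⟩
    (((a · d) · g) ⊖ ((c · b) · g)) ++ (((c · g) · b) ⊖ ((e · d) · b))
      ≈⟨ ++-cong (·-distribʳ-⊖ (a · d) (c · b) g) (·-distribʳ-⊖ (c · g) (e · d) b) ⟨
    (((a · d) ⊖ (c · b)) · g) ++ (((c · g) ⊖ (e · d)) · b)    ∎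
    where
    open import Relation.Binary.Reasoning.Setoid ~-setoid
    a = num x ; b = den x ; c = num y ; d = den y ; e = num z ; g = den z

  val-·den : ∀ p z → val (p · den z) ≡ val p +∞ denVal z
  val-·den p z = val-·ʳ p (den z) (denVal-isVal z)

  valDiff-ultra : ∀ x y z → valDiff x y ⊓∞ valDiff y z ≤∞ valDiff x z
  valDiff-ultra x y z = ≡.subst₂ _≤∞_ lhs rhs (+∞-monoˡ-≤∞ σ cocycle-bound)
    where
    vx = denVal x ; vy = denVal y ; vz = denVal z
    σ = ℚ.- ((vx ℚ.+ vy) ℚ.+ vz)

    cocycle-bound : (val (numDiff x y) +∞ vz) ⊓∞ (val (numDiff y z) +∞ vx) ≤∞ val (numDiff x z) +∞ vy
    cocycle-bound = ≡.subst₂ _≤∞_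
      (≡.cong₂ _⊓∞_ (val-·den (numDiff x y) z) (val-·den (numDiff y z) x))
      (≡.trans (≡.sym (val-~ (numDiff-cocycle x y z))) (val-·den (numDiff x z) y))
      (val-++ (numDiff x y · den z) (numDiff y z · den x))

    open +-*-Solver
    vz+σ : vz ℚ.+ σ ≡ ℚ.- (vx ℚ.+ vy)
    vz+σ = solve 3 (λ vx vy vz → vz :+ (:- ((vx :+ vy) :+ vz)) := :- (vx :+ vy)) ≡.refl vx vy vz
    vx+σ : vx ℚ.+ σ ≡ ℚ.- (vy ℚ.+ vz)
    vx+σ = solve 3 (λ vx vy vz → vx :+ (:- ((vx :+ vy) :+ vz)) := :- (vy :+ vz)) ≡.refl vx vy vz
    vy+σ : vy ℚ.+ σ ≡ ℚ.- (vx ℚ.+ vz)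
    vy+σ = solve 3 (λ vx vy vz → vy :+ (:- ((vx :+ vy) :+ vz)) := :- (vx :+ vz)) ≡.refl vx vy vz

    lhs : ((val (numDiff x y) +∞ vz) ⊓∞ (val (numDiff y z) +∞ vx)) +∞ σ ≡ valDiff x y ⊓∞ valDiff y z
    lhs = ≡.trans (⊓∞-+∞ (val (numDiff x y) +∞ vz) (val (numDiff y z) +∞ vx) σ) (≡.cong₂ _⊓∞_
      (≡.trans (+∞-+∞ (val (numDiff x y)) vz σ) (≡.cong (val (numDiff x y) +∞_) vz+σ))
      (≡.trans (+∞-+∞ (val (numDiff y z)) vx σ) (≡.cong (val (numDiff y z) +∞_) vx+σ)))

    rhs : (val (numDiff x z) +∞ vy) +∞ σ ≡ valDiff x z
    rhs = ≡.trans (+∞-+∞ (val (numDiff x z)) vy σ) (≡.cong (val (numDiff x z) +∞_) vy+σ)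

  valDiff-isValuationDistance : IsValuationDistance valDiff
  valDiff-isValuationDistance = record
    { self = λ x → valDiff-≃ {x} {x} (~-refl , ~-refl) ; sym = valDiff-sym ; ultra = valDiff-ultra }

  monomial : ℚ → K → Poly
  monomial e c = (e , c) ∷ []

  coeff-monomial : ∀ e c → coeff (monomial e c) e ≈ c
  coeff-monomial e c = trans (coeff-∷ (e , c) [] e) (trans (+-identityʳ _) (monomialCoeff-≡ e c))

  monomial-vanishesBelow : ∀ e c → VanishesBelow (monomial e c) (just e)
  monomial-vanishesBelow e c r r<e = trans (coeff-∷ (e , c) [] r) (trans (+-identityʳ _) (monomialCoeff-≢ c e≢r))
    where
    e≢r : e ≢ r
    e≢r e≡r = ℚ.<-irrefl (≡.sym e≡r) r<e

  monomial-isVal : ∀ e {c} → ¬ c ≈ 0# → IsVal (monomial e c) (just e)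
  monomial-isVal e {c} c≉0 =
    (λ c≈0 → c≉0 (trans (sym (coeff-monomial e c)) c≈0)) , monomial-vanishesBelow e c

  branch : Frac → ℚ → K → Frac
  branch x q c = record { num = num x ++ (monomial q c · den x) ; den = den x ; den≢0 = den≢0 x }

  denLowestCoeff : Frac → Frac → K
  denLowestCoeff x y = coeff (den x) (denVal x) * coeff (den y) (denVal y)

  denLowestCoeff≉0 : ∀ x y → ¬ denLowestCoeff x y ≈ 0#
  denLowestCoeff≉0 x y = no-zero-divisors (proj₁ (denVal-isVal x)) (proj₁ (denVal-isVal y))

  branchHeight : Frac → Frac → ℚ → ℚ
  branchHeight x y q = (q ℚ.+ denVal x) ℚ.+ denVal y

  module _ (x y : Frac) (q : ℚ) (c : K) where

    branchTerm : Poly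
    branchTerm = (monomial q c · den x) · den y

    numDiff-branch : numDiff (branch x q c) y ~ numDiff x y ++ branchTerm
    numDiff-branch = ~-trans
      (~-reflexive (≡.cong (_⊖ (num y · den x)) (·-distribʳ-++ (num x) (monomial q c · den x) (den y))))
      (++-⊖-comm (num x · den y) (num y · den x) branchTerm)

    branchTerm-lowest : coeff branchTerm (branchHeight x y q) ≈ c * denLowestCoeff x y
    branchTerm-lowest = begin
      coeff branchTerm (branchHeight x y q)
        ≈⟨ coeff-·-lowest (monomial q c · den x) (den y) Mb-low b'-low ⟩
      coeff (monomial q c · den x) (q ℚ.+ denVal x) * coeff (den y) (denVal y)
        ≈⟨ *-congʳ (coeff-·-lowest (monomial q c) (den x) (monomial-vanishesBelow q c) b-low) ⟩
      (coeff (monomial q c) q * coeff (den x) (denVal x)) * coeff (den y) (denVal y)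
        ≈⟨ *-congʳ (*-congʳ (coeff-monomial q c)) ⟩
      (c * coeff (den x) (denVal x)) * coeff (den y) (denVal y)
        ≈⟨ *-assoc _ _ _ ⟩
      c * denLowestCoeff x y ∎
      where
      open import Relation.Binary.Reasoning.Setoid setoid
      b-low = IsVal⇒VanishesBelow (den x) _ (denVal-isVal x)
      b'-low = IsVal⇒VanishesBelow (den y) _ (denVal-isVal y)
      Mb-low = ·-vanishesBelow (monomial q c) (den x) (just q) (monomial-vanishesBelow q c) b-low

    branchTerm-isVal : ¬ c ≈ 0# → IsVal branchTerm (just (branchHeight x y q))
    branchTerm-isVal c≉0 = IsVal-· (monomial q c · den x) (den y)
      (IsVal-· (monomial q c) (den x) (monomial-isVal q c≉0) (denVal-isVal x)) (denVal-isVal y)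

  denLowestCoeff⁻¹ : Frac → Frac → K
  denLowestCoeff⁻¹ x y = proj₁ (proj₂ isField (denLowestCoeff x y) (denLowestCoeff≉0 x y))

  denLowestCoeff-inverse : ∀ x y → denLowestCoeff x y * denLowestCoeff⁻¹ x y ≈ 1#
  denLowestCoeff-inverse x y = proj₂ (proj₂ isField (denLowestCoeff x y) (denLowestCoeff≉0 x y))

  -- The only c for which the lowest terms of numDiff x y ++ branchTerm x y q c cancel.
  cancellingCoeff : Frac → Frac → ℚ → K
  cancellingCoeff x y q = - coeff (numDiff x y) (branchHeight x y q) * denLowestCoeff⁻¹ x y

  valDiff-branch : ∀ x y q c → ¬ c ≈ 0# → ¬ c ≈ cancellingCoeff x y q →
    valDiff (branch x q c) y ≡ valDiff x y ⊓∞ just q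
  valDiff-branch x y q c c≉0 c≉cancelling = begin
    val (numDiff (branch x q c) y) +∞ ℚ.- E
      ≡⟨ ≡.cong (_+∞ ℚ.- E) (val-~ (numDiff-branch x y q c)) ⟩
    val (numDiff x y ++ branchTerm x y q c) +∞ ℚ.- E
      ≡⟨ ≡.cong (_+∞ ℚ.- E) (val-++-exact (numDiff x y) _ (branchTerm-isVal x y q c c≉0) noncancelling) ⟩
    (val (numDiff x y) ⊓∞ just (branchHeight x y q)) +∞ ℚ.- E
      ≡⟨ ⊓∞-+∞ (val (numDiff x y)) _ (ℚ.- E) ⟩
    valDiff x y ⊓∞ just (branchHeight x y q ℚ.- E)
      ≡⟨ ≡.cong (λ a → valDiff x y ⊓∞ just a) height-E≡q ⟩
    valDiff x y ⊓∞ just q ∎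
    where
    open ≡.≡-Reasoning
    E = denVal x ℚ.+ denVal y

    height-E≡q : branchHeight x y q ℚ.- E ≡ q
    height-E≡q = solve 3 (λ q a b → ((q :+ a) :+ b) :- (a :+ b) := q) ≡.refl q (denVal x) (denVal y)
      where open +-*-Solver

    noncancelling : ¬ coeff (numDiff x y ++ branchTerm x y q c) (branchHeight x y q) ≈ 0#
    noncancelling lowest≈0 = c≉cancelling (linear-root (denLowestCoeff-inverse x y)
      (trans (+-congˡ (sym (branchTerm-lowest x y q c))) (trans (sym (coeff-++ (numDiff x y) _ _)) lowest≈0)))

  valDiff-branching : BranchingProperty valDiff
  valDiff-branching x q n ys =
    branch x q c , λ j → valDiff-branch x (ys j) q c (c-fresh Fin.zero) (c-fresh (Fin.suc j))
    where
    avoided = fresh (0# Vector.∷ λ j → cancellingCoeff x (ys j) q)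
    c = proj₁ avoided
    c-fresh = proj₂ avoided

  one≉0 : ¬ (∀ q → coeff (monomial ℚ.0ℚ 1#) q ≈ 0#)
  one≉0 one≈0 = proj₁ isField (trans (sym (coeff-monomial ℚ.0ℚ 1#)) (one≈0 ℚ.0ℚ))

  -- n / d, or 0 / 1 when d = 0
  fraction : Poly → Poly → Frac
  fraction n d with val d | val-isVal d
  ... | nothing | _            = [] / monomial ℚ.0ℚ 1# [ one≉0 ]
  ... | just _  | (lead≉0 , _) = n / d [ (λ d≈0 → lead≉0 (d≈0 _)) ]

  fraction-exact : ∀ n d → ¬ (∀ q → coeff d q ≈ 0#) → num (fraction n d) ≡ n × den (fraction n d) ≡ d
  fraction-exact n d d≉0 with val d | val-isVal d
  ... | nothing | d≈0 = ⊥-elim (d≉0 d≈0)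
  ... | just _  | _   = ≡.refl , ≡.refl

  recode : ℚ × K → ℚ × K
  recode (e , c) = e , fromℕ (toℕ c)

  map-recode-~ : ∀ p → map recode p ~ p
  map-recode-~ p = coeffwise (go p)
    where
    open import Relation.Binary.Reasoning.Setoid setoid
    go : ∀ p r → coeff (map recode p) r ≈ coeff p r
    go []      r = refl
    go (t ∷ p) r = begin
      coeff (recode t ∷ map recode p) r                   ≈⟨ coeff-∷ (recode t) (map recode p) r ⟩
      monomialCoeff (recode t) r + coeff (map recode p) r ≈⟨ +-cong recode-t≈t (go p r) ⟩
      monomialCoeff t r + coeff p r                       ≈⟨ coeff-∷ t p r ⟨
      coeff (t ∷ p) r                                     ∎
      where
      recode-t≈t : monomialCoeff (recode t) r ≈ monomialCoeff t r
      recode-t≈t = monomialCoeff-cong {e = proj₁ t} {r = r} ≡.refl (fromℕ-toℕ (proj₂ t))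

  enumPoly : ℕ → Poly
  enumPoly k = map (λ (e , i) → e , fromℕ i) (enumList (enumℚ ⊗ id) k)

  enumPoly-onto : ∀ p → ∃ λ k → enumPoly k ~ p
  enumPoly-onto p
    with k , enum-k≡codes ← enumList-enumerates (⊗-enumerates enumℚ-enumerates (λ i → i , ≡.refl))
                                                (map (λ (e , c) → e , toℕ c) p)
    = k , ~-trans (~-reflexive (≡.trans (≡.cong (map _) enum-k≡codes) (≡.sym (map-∘ p)))) (map-recode-~ p)

  enumFrac : ℕ → Frac
  enumFrac k = fraction (enumPoly (proj₁ (unpair k))) (enumPoly (proj₂ (unpair k)))

  enumFrac-onto : ∀ x → ∃ λ k → enumFrac k ≃ x
  enumFrac-onto x
    with i , num~ ← enumPoly-onto (num x) | j , den~ ← enumPoly-onto (den x)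
    with k , hit ← unpair-hits (λ i j → fraction (enumPoly i) (enumPoly j)) i j
    = k , ≡.subst (_≃ x) (≡.sym hit)
            (~-trans (~-reflexive (proj₁ exact)) num~ , ~-trans (~-reflexive (proj₂ exact)) den~)
    where
    exact = fraction-exact (enumPoly i) (enumPoly j)
      (λ den≈0 → den≢0 x (λ q → trans (sym (coeff-≈ den~ q)) (den≈0 q)))

corollary3p33 : (R : CommutativeRing 0ℓ 0ℓ) → IsField R → CountablyInfinite R →
    (U : RationalUrysohn) → (ι : DistIso) →
    Σ (Series.Frac R → RationalUrysohn.Carrier U) λ f →
      (∀ u → ∃ λ x → f x ≡ u) ×
      (∀ x y (w : Maybe ℚ) → Series.IsValDiff R x y w →
        RationalUrysohn.d U (f x) (f y) ≡ DistIso.φ ι w)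
corollary3p33 R isField countable U ι = f , f-onto , λ x y w v≡w →
  ≡.trans (f-isometric x y) (≡.cong φ (valDiff-correct x y w v≡w))
  where
  open FractionDistance R isField countable
  open DistIso ι using (φ; φ-∞)

  enumFrac-dense : ∀ x → ∃ λ k → φ (valDiff (enumFrac k) x) ≡ 0ℚ
  enumFrac-dense x =
    proj₁ (enumFrac-onto x) , ≡.trans (≡.cong φ (valDiff-≃ (proj₂ (enumFrac-onto x)))) φ-∞

  isometry = isometry-onto-urysohn U
    (φ-isPseudoUltrametric ι valDiff-isValuationDistance)
    (φ-extensionProperty ι (enumFrac 0) valDiff-branching)
    enumFrac enumFrac-dense
  f = proj₁ isometry
  f-onto = proj₁ (proj₂ isometry)
  f-isometric = proj₂ (proj₂ isometry)
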